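{- Let $a$ be an odd natural number. For positive integers $n$ and $1\le i\le n$, let $t_i=\frac{i}{n}-\frac{1}{2n}$ and $$B_{i}^{(a)}=\sum_{j=1}^{a}\binom{a}{j}(-1)^{j+1}\sum_{k=1}^{j}\frac{\binom{n+k-1}{k+i-1}}{\binom{n+j}{i+j}(i+j)}(t_i)^{k-j}.$$ Then there are constants $b_{q_1,p_1}(a)$, independent of $i$ and $n$, such that for all $n$ and $1\le i\le n$ $$B_{i}^{(a)}=\frac{1}{(n+1)^{\overline{a}}}\sum_{(q_1,p_1)\in S_2} b_{q_1, p_1}(a)\,n^{a-1-q_1}\left(i-\frac{1}{2}\right)^{ -p_1},$$ where $S_2=\left\{(q_1,p_1)\in\mathbb{Z}^2: 0\le q_1,p_1\le a-1,\ q_1+p_1\ge \frac{a-1}{2}\right\}$, and moreover $$\sum_{q_1+p_1=\frac{a-1}{2}}\frac{2}{\sqrt{2\pi}}\,\mathrm{B}\!\left(a-p_1+\tfrac{1}{2},\tfrac{3}{2}\right)b_{q_1,p_1}(a)=\frac{\Gamma\left(\frac{a}{2}+1\right)}{2^{\frac{a}{2}}(1+a)},$$ the sum being over pairs $(q_1,p_1)\in S_2$ with $q_1+p_1=\frac{a-1}{2}$.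
   Context: $x^{\overline{k}}$ denotes the rising factorial: $x^{\overline{0}}=1$, $x^{\overline{k}}=x(x+1)\cdots(x+k-1)$ for $k\ge 1$. $\mathrm{B}(c,d)=\int_0^1x^{c-1}(1-x)^{d-1}dx$ is the Beta function and $\Gamma$ is the Gamma function. -}

module Defs where

open import Data.Nat as ℕ using (ℕ; zero; suc; _∸_; _≤ᵇ_)
open import Data.Nat.Combinatorics using (_C_)
open import Data.Nat using (_!)
open import Data.Integer using (+_)
open import Data.Rational using (ℚ; _/_; _+_; _*_; -_; 0ℚ; 1ℚ)
open import Data.Bool using (Bool; if_then_else_)

ℕ→ℚ : ℕ → ℚ
ℕ→ℚ m = (+ m) / 1

-- p / q as a rational; only ever used with q ≠ 0 (the value for q = 0 is junk)
divℕ : ℕ → ℕ → ℚ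
divℕ p zero    = 0ℚ
divℕ p (suc q) = (+ p) / suc q

_^ℚ_ : ℚ → ℕ → ℚ
x ^ℚ zero  = 1ℚ
x ^ℚ suc m = x * (x ^ℚ m)

sgn : ℕ → ℚ
sgn zero    = 1ℚ
sgn (suc m) = - sgn m

rising : ℕ → ℕ → ℕ
rising x zero    = 1
rising x (suc k) = rising x k ℕ.* (x ℕ.+ k)

Σ1 : ℕ → (ℕ → ℚ) → ℚ
Σ1 zero    f = 0ℚ
Σ1 (suc m) f = Σ1 m f + f (suc m)

Σ0 : ℕ → (ℕ → ℚ) → ℚ
Σ0 zero    f = 0ℚ
Σ0 (suc m) f = Σ0 m f + f m

-- 1 / t_i = 2n / (2i - 1), where t_i = i/n - 1/(2n)  (i ≥ 1; junk at i = 0)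
invT : ℕ → ℕ → ℚ
invT n zero     = 0ℚ
invT n (suc i') = (+ (2 ℕ.* n)) / suc (2 ℕ.* i')

-- (i - 1/2)^(-1) = 2 / (2i - 1)  (i ≥ 1; junk at i = 0)
invHalf : ℕ → ℚ
invHalf zero     = 0ℚ
invHalf (suc i') = (+ 2) / suc (2 ℕ.* i')

-- B_i^{(a)} = Σ_{j=1}^a C(a,j) (-1)^{j+1} Σ_{k=1}^j C(n+k-1,k+i-1) / (C(n+j,i+j) (i+j)) * t_i^{k-j}
-- (k - j ≤ 0, so t_i^{k-j} = (1/t_i)^{j-k})
B : ℕ → ℕ → ℕ → ℚ
B a n i = Σ1 a λ j → ℕ→ℚ (a C j) * sgn (suc j) *
            Σ1 j λ k → divℕ ((n ℕ.+ k ∸ 1) C (k ℕ.+ i ∸ 1))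
                            (((n ℕ.+ j) C (i ℕ.+ j)) ℕ.* (i ℕ.+ j))
                       * (invT n i ^ℚ (j ∸ k))

-- indicator of S₂ (with 0 ≤ q,p ≤ a-1 enforced by the summation range):
-- q + p ≥ (a-1)/2 ; for odd a, (a-1)/2 = a / 2 (floor) = a ∸ 1 over 2
half : ℕ → ℕ
half a = (a ∸ 1) ℕ./ 2

inS2 : ℕ → ℕ → ℕ → Bool
inS2 a q p = half a ≤ᵇ (q ℕ.+ p)

RHS : ℕ → (ℕ → ℕ → ℚ) → ℕ → ℕ → ℚ
RHS a b n i = divℕ 1 (rising (suc n) a) *
  Σ0 a λ q → Σ0 a λ p →
    (if inS2 a q p then b q p * ℕ→ℚ (n ℕ.^ (a ∸ 1 ∸ q)) * (invHalf i ^ℚ p) else 0ℚ)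

-- Γ(m + 1/2) / √π = (2m)! / (4^m m!)
Γhalf : ℕ → ℚ
Γhalf m = divℕ ((2 ℕ.* m) !) ((4 ℕ.^ m) ℕ.* (m !))

-- (2/√(2π)) · B(a - p + 1/2, 3/2) / √(2π), using
-- B(a-p+1/2, 3/2) = Γ(a-p+1/2) Γ(3/2) / Γ(a-p+2) = π · Γhalf(a-p) · (1/2) / (a-p+1)!
betaCoeff : ℕ → ℕ → ℚ
betaCoeff a p = Γhalf (a ∸ p) * divℕ 1 (2 ℕ.* ((suc (a ∸ p)) !))

-- Γ(a/2 + 1) / (2^{a/2} (1+a)) / √(2π) for odd a = 2h+1:
-- Γ(h + 1 + 1/2) = √π Γhalf(h+1), 2^{a/2} = √2 · 2^h
gammaRHS : ℕ → ℚ
gammaRHS a = Γhalf (suc (half a)) * divℕ 1 ((2 ℕ.^ suc (half a)) ℕ.* suc a)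

identityLHS : ℕ → (ℕ → ℕ → ℚ) → ℚ
identityLHS a b = Σ0 a λ q → Σ0 a λ p →
  (if (q ℕ.+ p) ℕ.≡ᵇ half a then betaCoeff a p * b q p else 0ℚ)

-- Fix n and i, put ε = 1/n and x = 1/(i − 1/2), and let F j be the inner sum over k in B, so that
-- B = −Σ_j (a choose j) (−1)^j F j = (−1)^(a+1) Δ^a F 0, which is Δ^a F 0 for odd a.
-- Absorbing binomial coefficients gives (n + j + 1) F (j+1) = (2n/(2i−1)) (i + j) F j + 1, i.e.
-- (1 + ε (j+1)) Δ F j = ε + (α + β j) F j with α = x/2 − ε and β = x − ε. Differencing this
-- (Leibniz rule for Δ^m (j g j)) yields a three-term recurrence for the moments Δ^k F 0; rescaled by
-- (n+1)^{\overline{k}} / n^k = Π_{l≤k} (1 + l ε) they become w_k with w₀ = 0, w₁ = ε and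
-- w_{m+2} = (α + K (β − ε)) w_{m+1} + K β (1 + ε K) w_m  (K = m + 1).
-- Running the same recurrence on polynomials in ε and x gives w_a = ε Σ b_{q,p} ε^q x^p with
-- coefficients b_{q,p} independent of n and i: this is the expansion.
-- Every step raises the degree q + p by one or two, so b_{q,p} = 0 unless ⌊a/2⌋ ≤ q + p < a.
-- On the lowest diagonal q + p = h of a = 2h + 1 only the term K β w_m survives, so by Pascal's rule
-- b_{q,h−q} = (−1)^q (h choose q) 2^h h!, and the identity reduces to the alternating binomial sum of
-- Beta values Σ_q (h choose q) (−1)^q B(h + q + 3/2, 3/2) = B(h + 3/2, h + 3/2), proved by induction on h.

module Submission where

open import Defs
open import Data.Nat using (ℕ; _≤_; _%_)
open import Data.Rational using (ℚ)
open import Data.Product using (∃; _×_)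
open import Relation.Binary.PropositionalEquality using (_≡_)

open import Data.Bool using (true; false; if_then_else_; T)
open import Data.Empty using (⊥-elim)
import Data.Integer as ℤ
import Data.Integer.Properties as ℤₚ
import Data.Integer.Tactic.RingSolver as ℤ-Solver
open import Data.Nat as ℕ using (zero; suc; _∸_; _<_; _!; s≤s; NonZero; ⌊_/2⌋; _≤ᵇ_; _≡ᵇ_)
open import Data.Nat.Combinatorics using (_C_; nC1≡n; nCn≡1; k>n⇒nCk≡0; nCk+nC[k+1]≡[n+1]C[k+1])
open import Data.Nat.DivMod using (m≡m%n+[m/n]*n; m*n/n≡m)
import Data.Nat.Properties as ℕₚ
import Data.Nat.Tactic.RingSolver as ℕ-Solver
open import Data.Product using (_,_)
open import Data.Rational using (_+_; _*_; -_; _-_; 0ℚ; 1ℚ; ½; toℚᵘ)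
import Data.Rational.Properties as ℚₚ
import Data.Rational.Unnormalised as ℚᵘ
import Data.Rational.Unnormalised.Properties as ℚᵘₚ
open import Data.Sum using (_⊎_; inj₁; inj₂)
open import Data.Unit using (tt)
open import Function using (_∘_)
open import Relation.Binary.PropositionalEquality using (refl; sym; trans; cong; cong₂; subst; _≢_; module ≡-Reasoning)
open import Relation.Nullary using (¬_; yes; no)
open import Relation.Nullary.Decidable using (dec⇒maybe)
open import Tactic.RingSolver using (solve-∀)
open import Tactic.RingSolver.Core.AlmostCommutativeRing using (AlmostCommutativeRing; fromCommutativeRing)

ℚ-ring : AlmostCommutativeRing _ _
ℚ-ring = fromCommutativeRing ℚₚ.+-*-commutativeRing (λ x → dec⇒maybe (0ℚ ℚₚ.≟ x))

toℚᵘ-divℕ : ∀ p q → toℚᵘ (divℕ p (suc q)) ℚᵘ.≃ ℚᵘ.mkℚᵘ (ℤ.+ p) q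
toℚᵘ-divℕ p q = ℚₚ.toℚᵘ-fromℚᵘ (ℚᵘ.mkℚᵘ (ℤ.+ p) q)

ℕ→ℚ-+ : ∀ m n → ℕ→ℚ (m ℕ.+ n) ≡ ℕ→ℚ m + ℕ→ℚ n
ℕ→ℚ-+ m n = ℚₚ.toℚᵘ-injective (begin
  toℚᵘ (ℕ→ℚ (m ℕ.+ n))                      ≈⟨ toℚᵘ-divℕ (m ℕ.+ n) 0 ⟩
  ℚᵘ.mkℚᵘ (ℤ.+ (m ℕ.+ n)) 0                 ≈⟨ ℚᵘ.*≡* (trans (cong (ℤ._* ℤ.+ 1) (ℤₚ.pos-+ m n))
                                                             (cross (ℤ.+ m) (ℤ.+ n))) ⟩
  ℚᵘ.mkℚᵘ (ℤ.+ m) 0 ℚᵘ.+ ℚᵘ.mkℚᵘ (ℤ.+ n) 0  ≈⟨ ℚᵘₚ.+-cong (toℚᵘ-divℕ m 0) (toℚᵘ-divℕ n 0) ⟨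
  toℚᵘ (ℕ→ℚ m) ℚᵘ.+ toℚᵘ (ℕ→ℚ n)            ≈⟨ ℚₚ.toℚᵘ-homo-+ (ℕ→ℚ m) (ℕ→ℚ n) ⟨
  toℚᵘ (ℕ→ℚ m + ℕ→ℚ n)                      ∎)
  where
  open ℚᵘₚ.≃-Reasoning
  cross : ∀ x y → (x ℤ.+ y) ℤ.* ℤ.+ 1 ≡ (x ℤ.* ℤ.+ 1 ℤ.+ y ℤ.* ℤ.+ 1) ℤ.* ℤ.+ 1
  cross = ℤ-Solver.solve-∀

ℕ→ℚ-* : ∀ m n → ℕ→ℚ (m ℕ.* n) ≡ ℕ→ℚ m * ℕ→ℚ n
ℕ→ℚ-* m n = ℚₚ.toℚᵘ-injective (begin
  toℚᵘ (ℕ→ℚ (m ℕ.* n))                      ≈⟨ toℚᵘ-divℕ (m ℕ.* n) 0 ⟩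
  ℚᵘ.mkℚᵘ (ℤ.+ (m ℕ.* n)) 0                 ≈⟨ ℚᵘ.*≡* (cong (ℤ._* ℤ.+ 1) (ℤₚ.pos-* m n)) ⟩
  ℚᵘ.mkℚᵘ (ℤ.+ m) 0 ℚᵘ.* ℚᵘ.mkℚᵘ (ℤ.+ n) 0  ≈⟨ ℚᵘₚ.*-cong (toℚᵘ-divℕ m 0) (toℚᵘ-divℕ n 0) ⟨
  toℚᵘ (ℕ→ℚ m) ℚᵘ.* toℚᵘ (ℕ→ℚ n)            ≈⟨ ℚₚ.toℚᵘ-homo-* (ℕ→ℚ m) (ℕ→ℚ n) ⟨
  toℚᵘ (ℕ→ℚ m * ℕ→ℚ n)                      ∎)
  where open ℚᵘₚ.≃-Reasoning

ℕ→ℚ-suc : ∀ m → ℕ→ℚ (suc m) ≡ 1ℚ + ℕ→ℚ m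
ℕ→ℚ-suc = ℕ→ℚ-+ 1

ℕ→ℚ-^ : ∀ m k → ℕ→ℚ (m ℕ.^ k) ≡ ℕ→ℚ m ^ℚ k
ℕ→ℚ-^ m zero    = refl
ℕ→ℚ-^ m (suc k) = trans (ℕ→ℚ-* m (m ℕ.^ k)) (cong (ℕ→ℚ m *_) (ℕ→ℚ-^ m k))

divℕ*q≡p : ∀ p q .{{_ : NonZero q}} → divℕ p q * ℕ→ℚ q ≡ ℕ→ℚ p
divℕ*q≡p p (suc q) = ℚₚ.toℚᵘ-injective (begin
  toℚᵘ (divℕ p (suc q) * ℕ→ℚ (suc q))            ≈⟨ ℚₚ.toℚᵘ-homo-* (divℕ p (suc q)) (ℕ→ℚ (suc q)) ⟩
  toℚᵘ (divℕ p (suc q)) ℚᵘ.* toℚᵘ (ℕ→ℚ (suc q))  ≈⟨ ℚᵘₚ.*-cong (toℚᵘ-divℕ p q) (toℚᵘ-divℕ (suc q) 0) ⟩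
  ℚᵘ.mkℚᵘ (ℤ.+ p) q ℚᵘ.* ℚᵘ.mkℚᵘ (ℤ.+ suc q) 0   ≈⟨ ℚᵘ.*≡* (cancel (ℤ.+ p) (ℤ.+ suc q)) ⟩
  ℚᵘ.mkℚᵘ (ℤ.+ p) 0                              ≈⟨ toℚᵘ-divℕ p 0 ⟨
  toℚᵘ (ℕ→ℚ p)                                   ∎)
  where
  open ℚᵘₚ.≃-Reasoning
  cancel : ∀ x y → (x ℤ.* y) ℤ.* ℤ.+ 1 ≡ x ℤ.* (y ℤ.* ℤ.+ 1)
  cancel = ℤ-Solver.solve-∀

recip : ℕ → ℚ
recip = divℕ 1

recip-inverseˡ : ∀ q .{{_ : NonZero q}} → recip q * ℕ→ℚ q ≡ 1ℚ
recip-inverseˡ = divℕ*q≡p 1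

recip-inverseʳ : ∀ q .{{_ : NonZero q}} → ℕ→ℚ q * recip q ≡ 1ℚ
recip-inverseʳ q = trans (ℚₚ.*-comm (ℕ→ℚ q) (recip q)) (recip-inverseˡ q)

ℕ→ℚ-*-cancelʳ : ∀ {x y} q .{{_ : NonZero q}} → x * ℕ→ℚ q ≡ y * ℕ→ℚ q → x ≡ y
ℕ→ℚ-*-cancelʳ {x} {y} q xq≡yq = begin
  x                      ≡⟨ ℚₚ.*-identityʳ x ⟨
  x * 1ℚ                 ≡⟨ cong (x *_) (recip-inverseʳ q) ⟨
  x * (ℕ→ℚ q * recip q)  ≡⟨ ℚₚ.*-assoc x (ℕ→ℚ q) (recip q) ⟨
  x * ℕ→ℚ q * recip q    ≡⟨ cong (_* recip q) xq≡yq ⟩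
  y * ℕ→ℚ q * recip q    ≡⟨ ℚₚ.*-assoc y (ℕ→ℚ q) (recip q) ⟩
  y * (ℕ→ℚ q * recip q)  ≡⟨ cong (y *_) (recip-inverseʳ q) ⟩
  y * 1ℚ                 ≡⟨ ℚₚ.*-identityʳ y ⟩
  y                      ∎
  where open ≡-Reasoning

divℕ≡*recip : ∀ p q .{{_ : NonZero q}} → divℕ p q ≡ ℕ→ℚ p * recip q
divℕ≡*recip p q = ℕ→ℚ-*-cancelʳ q (begin
  divℕ p q * ℕ→ℚ q              ≡⟨ divℕ*q≡p p q ⟩
  ℕ→ℚ p                         ≡⟨ ℚₚ.*-identityʳ (ℕ→ℚ p) ⟨
  ℕ→ℚ p * 1ℚ                    ≡⟨ cong (ℕ→ℚ p *_) (recip-inverseˡ q) ⟨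
  ℕ→ℚ p * (recip q * ℕ→ℚ q)     ≡⟨ ℚₚ.*-assoc (ℕ→ℚ p) (recip q) (ℕ→ℚ q) ⟨
  ℕ→ℚ p * recip q * ℕ→ℚ q       ∎)
  where open ≡-Reasoning

recip-* : ∀ m n .{{_ : NonZero m}} .{{_ : NonZero n}} →
          recip (m ℕ.* n) ≡ recip m * recip n
recip-* m n = ℕ→ℚ-*-cancelʳ (m ℕ.* n) {{ℕₚ.m*n≢0 m n}} (begin
  recip (m ℕ.* n) * ℕ→ℚ (m ℕ.* n)               ≡⟨ recip-inverseˡ (m ℕ.* n) {{ℕₚ.m*n≢0 m n}} ⟩
  1ℚ                                            ≡⟨ cong₂ _*_ (recip-inverseˡ m) (recip-inverseˡ n) ⟨
  (recip m * ℕ→ℚ m) * (recip n * ℕ→ℚ n)         ≡⟨ interchange (recip m) (ℕ→ℚ m) (recip n) (ℕ→ℚ n) ⟩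
  recip m * recip n * (ℕ→ℚ m * ℕ→ℚ n)           ≡⟨ cong (recip m * recip n *_) (ℕ→ℚ-* m n) ⟨
  recip m * recip n * ℕ→ℚ (m ℕ.* n)             ∎)
  where
  open ≡-Reasoning
  interchange : ∀ a b c d → (a * b) * (c * d) ≡ a * c * (b * d)
  interchange = solve-∀ ℚ-ring

*-divℕ-cancelˡ : ∀ m p q .{{_ : NonZero m}} .{{_ : NonZero q}} →
                 ℕ→ℚ m * divℕ p (m ℕ.* q) ≡ divℕ p q
*-divℕ-cancelˡ m p q = begin
  ℕ→ℚ m * divℕ p (m ℕ.* q)                ≡⟨ cong (ℕ→ℚ m *_) (divℕ≡*recip p (m ℕ.* q) {{ℕₚ.m*n≢0 m q}}) ⟩
  ℕ→ℚ m * (ℕ→ℚ p * recip (m ℕ.* q))        ≡⟨ cong (λ r → ℕ→ℚ m * (ℕ→ℚ p * r)) (recip-* m q) ⟩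
  ℕ→ℚ m * (ℕ→ℚ p * (recip m * recip q))    ≡⟨ regroup (ℕ→ℚ m) (ℕ→ℚ p) (recip m) (recip q) ⟩
  (ℕ→ℚ m * recip m) * (ℕ→ℚ p * recip q)    ≡⟨ cong (_* (ℕ→ℚ p * recip q)) (recip-inverseʳ m) ⟩
  1ℚ * (ℕ→ℚ p * recip q)                  ≡⟨ ℚₚ.*-identityˡ _ ⟩
  ℕ→ℚ p * recip q                         ≡⟨ divℕ≡*recip p q ⟨
  divℕ p q                                ∎
  where
  open ≡-Reasoning
  regroup : ∀ a b c d → a * (b * (c * d)) ≡ (a * c) * (b * d)
  regroup = solve-∀ ℚ-ring

*-divℕ : ∀ m p q .{{_ : NonZero q}} → ℕ→ℚ m * divℕ p q ≡ divℕ (m ℕ.* p) q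
*-divℕ m p q = begin
  ℕ→ℚ m * divℕ p q               ≡⟨ cong (ℕ→ℚ m *_) (divℕ≡*recip p q) ⟩
  ℕ→ℚ m * (ℕ→ℚ p * recip q)      ≡⟨ ℚₚ.*-assoc (ℕ→ℚ m) (ℕ→ℚ p) (recip q) ⟨
  ℕ→ℚ m * ℕ→ℚ p * recip q        ≡⟨ cong (_* recip q) (ℕ→ℚ-* m p) ⟨
  ℕ→ℚ (m ℕ.* p) * recip q        ≡⟨ divℕ≡*recip (m ℕ.* p) q ⟨
  divℕ (m ℕ.* p) q               ∎
  where open ≡-Reasoning

divℕ-cross : ∀ p q p′ q′ .{{_ : NonZero q}} .{{_ : NonZero q′}} →
             p ℕ.* q′ ≡ p′ ℕ.* q → divℕ p q ≡ divℕ p′ q′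
divℕ-cross p q p′ q′ pq′≡p′q = ℕ→ℚ-*-cancelʳ (q ℕ.* q′) {{ℕₚ.m*n≢0 q q′}} (begin
  divℕ p q * ℕ→ℚ (q ℕ.* q′)             ≡⟨ cong (divℕ p q *_) (ℕ→ℚ-* q q′) ⟩
  divℕ p q * (ℕ→ℚ q * ℕ→ℚ q′)           ≡⟨ ℚₚ.*-assoc (divℕ p q) (ℕ→ℚ q) (ℕ→ℚ q′) ⟨
  divℕ p q * ℕ→ℚ q * ℕ→ℚ q′             ≡⟨ cong (_* ℕ→ℚ q′) (divℕ*q≡p p q) ⟩
  ℕ→ℚ p * ℕ→ℚ q′                        ≡⟨ ℕ→ℚ-* p q′ ⟨
  ℕ→ℚ (p ℕ.* q′)                        ≡⟨ cong ℕ→ℚ pq′≡p′q ⟩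
  ℕ→ℚ (p′ ℕ.* q)                        ≡⟨ ℕ→ℚ-* p′ q ⟩
  ℕ→ℚ p′ * ℕ→ℚ q                        ≡⟨ cong (λ t → t * ℕ→ℚ q) (divℕ*q≡p p′ q′) ⟨
  divℕ p′ q′ * ℕ→ℚ q′ * ℕ→ℚ q           ≡⟨ swap (divℕ p′ q′) (ℕ→ℚ q′) (ℕ→ℚ q) ⟩
  divℕ p′ q′ * (ℕ→ℚ q * ℕ→ℚ q′)         ≡⟨ cong (divℕ p′ q′ *_) (ℕ→ℚ-* q q′) ⟨
  divℕ p′ q′ * ℕ→ℚ (q ℕ.* q′)           ∎)
  where
  open ≡-Reasoning
  swap : ∀ a b c → a * b * c ≡ a * (c * b)
  swap = solve-∀ ℚ-ring

recip-! : ∀ m → recip (m !) ≡ ℕ→ℚ (suc m) * recip (suc m !)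
recip-! m = sym (*-divℕ-cancelˡ (suc m) 1 (m !) {{_}} {{m ℕₚ.!≢0}})

divℕ-*-recip : ∀ p q r .{{_ : NonZero q}} .{{_ : NonZero r}} → divℕ p q * recip r ≡ divℕ p (q ℕ.* r)
divℕ-*-recip p q r = begin
  divℕ p q * recip r                ≡⟨ cong (_* recip r) (divℕ≡*recip p q) ⟩
  ℕ→ℚ p * recip q * recip r         ≡⟨ ℚₚ.*-assoc (ℕ→ℚ p) (recip q) (recip r) ⟩
  ℕ→ℚ p * (recip q * recip r)       ≡⟨ cong (ℕ→ℚ p *_) (recip-* q r) ⟨
  ℕ→ℚ p * recip (q ℕ.* r)           ≡⟨ divℕ≡*recip p (q ℕ.* r) {{ℕₚ.m*n≢0 q r}} ⟨
  divℕ p (q ℕ.* r)                  ∎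
  where open ≡-Reasoning

^ℚ-cancel : ∀ {x y} → x * y ≡ 1ℚ → ∀ s k → x ^ℚ (s ℕ.+ k) * y ^ℚ s ≡ x ^ℚ k
^ℚ-cancel xy≡1 zero    k = ℚₚ.*-identityʳ _
^ℚ-cancel {x} {y} xy≡1 (suc s) k = begin
  x * x ^ℚ (s ℕ.+ k) * (y * y ^ℚ s)     ≡⟨ regroup x (x ^ℚ (s ℕ.+ k)) y (y ^ℚ s) ⟩
  x * y * (x ^ℚ (s ℕ.+ k) * y ^ℚ s)     ≡⟨ cong₂ _*_ xy≡1 (^ℚ-cancel xy≡1 s k) ⟩
  1ℚ * x ^ℚ k                           ≡⟨ ℚₚ.*-identityˡ _ ⟩
  x ^ℚ k                                ∎
  where
  open ≡-Reasoning
  regroup : ∀ a b c d → a * b * (c * d) ≡ a * c * (b * d)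
  regroup = solve-∀ ℚ-ring

Σ0-suc : ∀ m f → Σ0 (suc m) f ≡ f 0 + Σ0 m (λ j → f (suc j))
Σ0-suc zero    f = ℚₚ.+-comm 0ℚ (f 0)
Σ0-suc (suc m) f = begin
  Σ0 (suc m) f + f (suc m)                    ≡⟨ cong (_+ f (suc m)) (Σ0-suc m f) ⟩
  f 0 + Σ0 m (λ j → f (suc j)) + f (suc m)    ≡⟨ ℚₚ.+-assoc (f 0) _ (f (suc m)) ⟩
  f 0 + Σ0 (suc m) (λ j → f (suc j))          ∎
  where open ≡-Reasoning

Σ1≡Σ0 : ∀ m f → Σ1 m f ≡ Σ0 m (λ j → f (suc j))
Σ1≡Σ0 zero    f = refl
Σ1≡Σ0 (suc m) f = cong (_+ f (suc m)) (Σ1≡Σ0 m f)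

Σ0-cong : ∀ m {f g} → (∀ j → j < m → f j ≡ g j) → Σ0 m f ≡ Σ0 m g
Σ0-cong zero    f≡g = refl
Σ0-cong (suc m) f≡g =
  cong₂ _+_ (Σ0-cong m (λ j j<m → f≡g j (ℕₚ.m<n⇒m<1+n j<m))) (f≡g m (ℕₚ.n<1+n m))

Σ0-distrib-+ : ∀ m f g → Σ0 m (λ j → f j + g j) ≡ Σ0 m f + Σ0 m g
Σ0-distrib-+ zero    f g = refl
Σ0-distrib-+ (suc m) f g =
  trans (cong (_+ (f m + g m)) (Σ0-distrib-+ m f g)) (interchange (Σ0 m f) (Σ0 m g) (f m) (g m))
  where
  interchange : ∀ a b c d → a + b + (c + d) ≡ a + c + (b + d)
  interchange = solve-∀ ℚ-ring

*-distribˡ-Σ0 : ∀ m c f → c * Σ0 m f ≡ Σ0 m (λ j → c * f j)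
*-distribˡ-Σ0 zero    c f = ℚₚ.*-zeroʳ c
*-distribˡ-Σ0 (suc m) c f =
  trans (ℚₚ.*-distribˡ-+ c (Σ0 m f) (f m)) (cong (_+ c * f m) (*-distribˡ-Σ0 m c f))

Σ0-neg : ∀ m f → Σ0 m (λ j → - f j) ≡ - Σ0 m f
Σ0-neg zero    f = refl
Σ0-neg (suc m) f =
  trans (cong (_+ - f m) (Σ0-neg m f)) (sym (ℚₚ.neg-distrib-+ (Σ0 m f) (f m)))

Σ0-zero : ∀ m {f} → (∀ j → j < m → f j ≡ 0ℚ) → Σ0 m f ≡ 0ℚ
Σ0-zero zero    f≡0 = refl
Σ0-zero (suc m) f≡0 =
  cong₂ _+_ (Σ0-zero m (λ j j<m → f≡0 j (ℕₚ.m<n⇒m<1+n j<m))) (f≡0 m (ℕₚ.n<1+n m))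

Σ0-single : ∀ m t {f} → t < m → (∀ j → j < m → j ≢ t → f j ≡ 0ℚ) → Σ0 m f ≡ f t
Σ0-single (suc m) t {f} t<1+m others with t ℕₚ.≟ m
... | yes refl = trans (cong (_+ f t) (Σ0-zero m (λ j j<m → others j (ℕₚ.m<n⇒m<1+n j<m) (ℕₚ.<⇒≢ j<m))))
                       (ℚₚ.+-identityˡ (f t))
... | no t≢m   = trans (cong₂ _+_ (Σ0-single m t (ℕₚ.≤∧≢⇒< (ℕₚ.≤-pred t<1+m) t≢m)
                                                 (λ j j<m → others j (ℕₚ.m<n⇒m<1+n j<m)))
                                  (others m (ℕₚ.n<1+n m) (t≢m ∘ sym)))
                       (ℚₚ.+-identityʳ (f t))

Σ0-truncate : ∀ k d {f} → (∀ j → k ≤ j → f j ≡ 0ℚ) → Σ0 (k ℕ.+ d) f ≡ Σ0 k f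
Σ0-truncate k zero    {f} _   = cong (λ m → Σ0 m f) (ℕₚ.+-identityʳ k)
Σ0-truncate k (suc d) {f} f≡0 = begin
  Σ0 (k ℕ.+ suc d) f            ≡⟨ cong (λ m → Σ0 m f) (ℕₚ.+-suc k d) ⟩
  Σ0 (k ℕ.+ d) f + f (k ℕ.+ d)  ≡⟨ cong₂ _+_ (Σ0-truncate k d f≡0) (f≡0 (k ℕ.+ d) (ℕₚ.m≤m+n k d)) ⟩
  Σ0 k f + 0ℚ                   ≡⟨ ℚₚ.+-identityʳ (Σ0 k f) ⟩
  Σ0 k f                        ∎
  where open ≡-Reasoning

if-true : ∀ {b} {y z : ℚ} → T b → (if b then y else z) ≡ y
if-true {true} _ = refl

if-false : ∀ {b} {y z : ℚ} → ¬ T b → (if b then y else z) ≡ z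
if-false {false} _  = refl
if-false {true}  ¬b = ⊥-elim (¬b tt)

Σ0-diagonal : ∀ A k q (g : ℕ → ℚ) → q ≤ k → k < A →
              Σ0 A (λ p → if (q ℕ.+ p) ≡ᵇ k then g p else 0ℚ) ≡ g (k ∸ q)
Σ0-diagonal A k q g q≤k k<A = begin
  Σ0 A (λ p → if (q ℕ.+ p) ≡ᵇ k then g p else 0ℚ)
    ≡⟨ Σ0-single A (k ∸ q) (ℕₚ.≤-<-trans (ℕₚ.m∸n≤m k q) k<A) off-diagonal ⟩
  (if (q ℕ.+ (k ∸ q)) ≡ᵇ k then g (k ∸ q) else 0ℚ)
    ≡⟨ if-true (ℕₚ.≡⇒≡ᵇ _ _ (ℕₚ.m+[n∸m]≡n q≤k)) ⟩
  g (k ∸ q)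
    ∎
  where
  open ≡-Reasoning
  off-diagonal : ∀ p → p < A → p ≢ k ∸ q → (if (q ℕ.+ p) ≡ᵇ k then g p else 0ℚ) ≡ 0ℚ
  off-diagonal p _ p≢k∸q =
    if-false (λ t → p≢k∸q (trans (sym (ℕₚ.m+n∸m≡n q p)) (cong (_∸ q) (ℕₚ.≡ᵇ⇒≡ _ _ t))))

Σ0-diagonal-empty : ∀ A k q (g : ℕ → ℚ) → k < q → Σ0 A (λ p → if (q ℕ.+ p) ≡ᵇ k then g p else 0ℚ) ≡ 0ℚ
Σ0-diagonal-empty A k q g k<q =
  Σ0-zero A (λ p _ → if-false (λ t → ℕₚ.<⇒≱ k<q (subst (q ≤_) (ℕₚ.≡ᵇ⇒≡ _ _ t) (ℕₚ.m≤m+n q p))))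

-- Finite differences

Δ : (ℕ → ℚ) → ℕ → ℚ
Δ f j = f (suc j) - f j

Δ^ : ℕ → (ℕ → ℚ) → ℕ → ℚ
Δ^ zero    f = f
Δ^ (suc m) f = Δ^ m (Δ f)

Δ^-cong : ∀ m {f g} → (∀ j → f j ≡ g j) → ∀ j → Δ^ m f j ≡ Δ^ m g j
Δ^-cong zero    f≡g = f≡g
Δ^-cong (suc m) f≡g = Δ^-cong m (λ j → cong₂ _-_ (f≡g (suc j)) (f≡g j))

Δ^-+ : ∀ m f g j → Δ^ m (λ j → f j + g j) j ≡ Δ^ m f j + Δ^ m g j
Δ^-+ zero    f g j = refl
Δ^-+ (suc m) f g j =
  trans (Δ^-cong m (λ j → regroup (f (suc j)) (g (suc j)) (f j) (g j)) j) (Δ^-+ m (Δ f) (Δ g) j)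
  where
  regroup : ∀ a b c d → a + b - (c + d) ≡ (a - c) + (b - d)
  regroup = solve-∀ ℚ-ring

Δ^-* : ∀ m c f j → Δ^ m (λ j → c * f j) j ≡ c * Δ^ m f j
Δ^-* zero    c f j = refl
Δ^-* (suc m) c f j =
  trans (Δ^-cong m (λ j → factor c (f (suc j)) (f j)) j) (Δ^-* m c (Δ f) j)
  where
  factor : ∀ c a b → c * a - c * b ≡ c * (a - b)
  factor = solve-∀ ℚ-ring

Δ^-const : ∀ m c j → Δ^ (suc m) (λ _ → c) j ≡ 0ℚ
Δ^-const zero    c j = ℚₚ.+-inverseʳ c
Δ^-const (suc m) c j = trans (Δ^-cong (suc m) (λ _ → ℚₚ.+-inverseʳ c) j) (Δ^-const m 0ℚ j)

Δ^-shift : ∀ m f j → Δ^ m (λ j → f (suc j)) j ≡ Δ^ m f (suc j)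
Δ^-shift zero    f j = refl
Δ^-shift (suc m) f j = Δ^-shift m (Δ f) j

Δ^-suc : ∀ m f j → Δ^ (suc m) f j ≡ Δ (Δ^ m f) j
Δ^-suc zero    f j = refl
Δ^-suc (suc m) f j = Δ^-suc m (Δ f) j

Δ^-step : ∀ m f j → Δ^ m f (suc j) ≡ Δ^ m f j + Δ^ (suc m) f j
Δ^-step m f j = trans (telescope (Δ^ m f (suc j)) (Δ^ m f j)) (cong (Δ^ m f j +_) (sym (Δ^-suc m f j)))
  where
  telescope : ∀ a b → a ≡ b + (a - b)
  telescope = solve-∀ ℚ-ring

Δ-leibniz : ∀ u j → Δ (λ j → ℕ→ℚ j * u j) j ≡ ℕ→ℚ j * Δ u j + u (suc j)
Δ-leibniz u j = trans (cong (λ s → s * u (suc j) - ℕ→ℚ j * u j) (ℕ→ℚ-suc j))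
                      (expand (ℕ→ℚ j) (u (suc j)) (u j))
  where
  expand : ∀ x a b → (1ℚ + x) * a - x * b ≡ x * (a - b) + a
  expand = solve-∀ ℚ-ring

Δ^-leibniz : ∀ m u j → Δ^ (suc m) (λ j → ℕ→ℚ j * u j) j
                       ≡ ℕ→ℚ j * Δ^ (suc m) u j + ℕ→ℚ (suc m) * Δ^ m u (suc j)
Δ^-leibniz zero    u j = trans (Δ-leibniz u j) (cong (ℕ→ℚ j * Δ u j +_) (sym (ℚₚ.*-identityˡ (u (suc j)))))
Δ^-leibniz (suc m) u j = begin
  Δ^ (suc m) (Δ (λ j → J j * u j)) j
    ≡⟨ Δ^-cong (suc m) (Δ-leibniz u) j ⟩
  Δ^ (suc m) (λ j → J j * Δ u j + u (suc j)) j
    ≡⟨ Δ^-+ (suc m) (λ j → J j * Δ u j) (λ j → u (suc j)) j ⟩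
  Δ^ (suc m) (λ j → J j * Δ u j) j + Δ^ (suc m) (λ j → u (suc j)) j
    ≡⟨ cong₂ _+_ (Δ^-leibniz m (Δ u) j) (Δ^-shift (suc m) u j) ⟩
  J j * Δ^ (suc (suc m)) u j + K * Δ^ (suc m) u (suc j) + Δ^ (suc m) u (suc j)
    ≡⟨ collect (J j) (Δ^ (suc (suc m)) u j) K (Δ^ (suc m) u (suc j)) ⟩
  J j * Δ^ (suc (suc m)) u j + (1ℚ + K) * Δ^ (suc m) u (suc j)
    ≡⟨ cong (λ k → J j * Δ^ (suc (suc m)) u j + k * Δ^ (suc m) u (suc j)) (ℕ→ℚ-suc (suc m)) ⟨
  J j * Δ^ (suc (suc m)) u j + J (suc (suc m)) * Δ^ (suc m) u (suc j)
    ∎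
  where
  open ≡-Reasoning
  J = ℕ→ℚ
  K = J (suc m)
  collect : ∀ x a k b → x * a + k * b + b ≡ x * a + (1ℚ + k) * b
  collect = solve-∀ ℚ-ring

Δ^-affine : ∀ m a b g → Δ^ (suc m) (λ j → a * g j + b * (ℕ→ℚ j * g j)) 0
                        ≡ a * Δ^ (suc m) g 0 + b * (ℕ→ℚ (suc m) * (Δ^ m g 0 + Δ^ (suc m) g 0))
Δ^-affine m a b g = begin
  Δ^ (suc m) (λ j → a * g j + b * (ℕ→ℚ j * g j)) 0
    ≡⟨ Δ^-+ (suc m) (λ j → a * g j) (λ j → b * (ℕ→ℚ j * g j)) 0 ⟩
  Δ^ (suc m) (λ j → a * g j) 0 + Δ^ (suc m) (λ j → b * (ℕ→ℚ j * g j)) 0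
    ≡⟨ cong₂ _+_ (Δ^-* (suc m) a g 0) (Δ^-* (suc m) b (λ j → ℕ→ℚ j * g j) 0) ⟩
  a * Δ^ (suc m) g 0 + b * Δ^ (suc m) (λ j → ℕ→ℚ j * g j) 0
    ≡⟨ cong (λ t → a * Δ^ (suc m) g 0 + b * t) (Δ^-leibniz m g 0) ⟩
  a * Δ^ (suc m) g 0 + b * (0ℚ * Δ^ (suc m) g 0 + ℕ→ℚ (suc m) * Δ^ m g 1)
    ≡⟨ cong (λ t → a * Δ^ (suc m) g 0 + b * (0ℚ * Δ^ (suc m) g 0 + ℕ→ℚ (suc m) * t)) (Δ^-step m g 0) ⟩
  a * Δ^ (suc m) g 0 + b * (0ℚ * Δ^ (suc m) g 0 + ℕ→ℚ (suc m) * (Δ^ m g 0 + Δ^ (suc m) g 0))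
    ≡⟨ drop (a * Δ^ (suc m) g 0) b (Δ^ (suc m) g 0) (ℕ→ℚ (suc m) * (Δ^ m g 0 + Δ^ (suc m) g 0)) ⟩
  a * Δ^ (suc m) g 0 + b * (ℕ→ℚ (suc m) * (Δ^ m g 0 + Δ^ (suc m) g 0))
    ∎
  where
  open ≡-Reasoning
  drop : ∀ s b y t → s + b * (0ℚ * y + t) ≡ s + b * t
  drop = solve-∀ ℚ-ring

binomialSum : ℕ → (ℕ → ℚ) → ℚ
binomialSum a f = Σ0 (suc a) (λ j → ℕ→ℚ (a C j) * sgn j * f j)

binomialSum-cong : ∀ a {f g} → (∀ j → f j ≡ g j) → binomialSum a f ≡ binomialSum a g
binomialSum-cong a f≡g = Σ0-cong (suc a) (λ j _ → cong (ℕ→ℚ (a C j) * sgn j *_) (f≡g j))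

binomialSum-Δ : ∀ a f → binomialSum a (Δ f) ≡ binomialSum a (λ j → f (suc j)) - binomialSum a f
binomialSum-Δ a f = begin
  binomialSum a (Δ f)
    ≡⟨ Σ0-cong (suc a) (λ j _ → distrib (ℕ→ℚ (a C j) * sgn j) (f (suc j)) (f j)) ⟩
  Σ0 (suc a) (λ j → w j * f (suc j) + - (w j * f j))
    ≡⟨ Σ0-distrib-+ (suc a) (λ j → w j * f (suc j)) (λ j → - (w j * f j)) ⟩
  binomialSum a (λ j → f (suc j)) + Σ0 (suc a) (λ j → - (w j * f j))
    ≡⟨ cong (binomialSum a (λ j → f (suc j)) +_) (Σ0-neg (suc a) (λ j → w j * f j)) ⟩
  binomialSum a (λ j → f (suc j)) - binomialSum a f
    ∎
  where
  open ≡-Reasoning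
  w : ℕ → ℚ
  w j = ℕ→ℚ (a C j) * sgn j
  distrib : ∀ c x y → c * (x - y) ≡ c * x + - (c * y)
  distrib = solve-∀ ℚ-ring

binomialSum-suc : ∀ a f → binomialSum (suc a) f ≡ binomialSum a f - binomialSum a (λ j → f (suc j))
binomialSum-suc a f = begin
  Σ0 (suc (suc a)) g
    ≡⟨ Σ0-suc (suc a) g ⟩
  g 0 + Σ0 (suc a) (λ j → g (suc j))
    ≡⟨ cong (g 0 +_) (Σ0-cong (suc a) (λ j _ → pascal j)) ⟩
  g 0 + Σ0 (suc a) (λ j → h (suc j) + - h′ j)
    ≡⟨ cong (g 0 +_) (Σ0-distrib-+ (suc a) (λ j → h (suc j)) (λ j → - h′ j)) ⟩
  g 0 + (Σ0 a (λ j → h (suc j)) + h (suc a) + Σ0 (suc a) (λ j → - h′ j))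
    ≡⟨ cong₂ (λ s t → g 0 + (Σ0 a (λ j → h (suc j)) + s + t)) h[1+a]≡0 (Σ0-neg (suc a) h′) ⟩
  g 0 + (Σ0 a (λ j → h (suc j)) + 0ℚ + - binomialSum a (λ j → f (suc j)))
    ≡⟨ regroup (g 0) (Σ0 a (λ j → h (suc j))) (binomialSum a (λ j → f (suc j))) ⟩
  h 0 + Σ0 a (λ j → h (suc j)) - binomialSum a (λ j → f (suc j))
    ≡⟨ cong (_- binomialSum a (λ j → f (suc j))) (Σ0-suc a h) ⟨
  binomialSum a f - binomialSum a (λ j → f (suc j))
    ∎
  where
  open ≡-Reasoning
  g h h′ : ℕ → ℚ
  g  j = ℕ→ℚ (suc a C j) * sgn j * f j
  h  j = ℕ→ℚ (a C j) * sgn j * f j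
  h′ j = ℕ→ℚ (a C j) * sgn j * f (suc j)
  pascal : ∀ j → g (suc j) ≡ h (suc j) + - h′ j
  pascal j = begin
    ℕ→ℚ (suc a C suc j) * - sgn j * f (suc j)
      ≡⟨ cong (λ c → ℕ→ℚ c * - sgn j * f (suc j)) (nCk+nC[k+1]≡[n+1]C[k+1] a j) ⟨
    ℕ→ℚ (a C j ℕ.+ a C suc j) * - sgn j * f (suc j)
      ≡⟨ cong (λ c → c * - sgn j * f (suc j)) (ℕ→ℚ-+ (a C j) (a C suc j)) ⟩
    (ℕ→ℚ (a C j) + ℕ→ℚ (a C suc j)) * - sgn j * f (suc j)
      ≡⟨ expand (ℕ→ℚ (a C j)) (ℕ→ℚ (a C suc j)) (sgn j) (f (suc j)) ⟩
    h (suc j) + - h′ j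
      ∎
    where
    expand : ∀ c c′ s y → (c + c′) * - s * y ≡ c′ * - s * y + - (c * s * y)
    expand = solve-∀ ℚ-ring
  h[1+a]≡0 : h (suc a) ≡ 0ℚ
  h[1+a]≡0 = begin
    ℕ→ℚ (a C suc a) * sgn (suc a) * f (suc a)
      ≡⟨ cong (λ c → ℕ→ℚ c * sgn (suc a) * f (suc a)) (k>n⇒nCk≡0 (ℕₚ.n<1+n a)) ⟩
    0ℚ * sgn (suc a) * f (suc a)               ≡⟨ annihilate (sgn (suc a)) (f (suc a)) ⟩
    0ℚ                                         ∎
    where
    annihilate : ∀ s y → 0ℚ * s * y ≡ 0ℚ
    annihilate = solve-∀ ℚ-ring
  regroup : ∀ x s t → x + (s + 0ℚ + - t) ≡ x + s - t
  regroup = solve-∀ ℚ-ring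

binomialSum≡Δ^ : ∀ a f → binomialSum a f ≡ sgn a * Δ^ a f 0
binomialSum≡Δ^ zero    f = initial (f 0)
  where
  initial : ∀ y → 0ℚ + 1ℚ * 1ℚ * y ≡ 1ℚ * y
  initial = solve-∀ ℚ-ring
binomialSum≡Δ^ (suc a) f = begin
  binomialSum (suc a) f                                  ≡⟨ binomialSum-suc a f ⟩
  binomialSum a f - binomialSum a (λ j → f (suc j))      ≡⟨ swap (binomialSum a f) (binomialSum a (λ j → f (suc j))) ⟩
  - (binomialSum a (λ j → f (suc j)) - binomialSum a f)  ≡⟨ cong -_ (binomialSum-Δ a f) ⟨
  - binomialSum a (Δ f)                                  ≡⟨ cong -_ (binomialSum≡Δ^ a (Δ f)) ⟩
  - (sgn a * Δ^ a (Δ f) 0)                               ≡⟨ ℚₚ.neg-distribˡ-* (sgn a) (Δ^ a (Δ f) 0) ⟩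
  sgn (suc a) * Δ^ (suc a) f 0                           ∎
  where
  open ≡-Reasoning
  swap : ∀ x y → x - y ≡ - (y - x)
  swap = solve-∀ ℚ-ring

nCk≢0 : ∀ {n k} → k ≤ n → NonZero (n C k)
nCk≢0 {n}     {zero}  _         = _
nCk≢0 {suc n} {suc k} (s≤s k≤n) = ℕ.>-nonZero (begin-strict
  0                          <⟨ ℕ.>-nonZero⁻¹ (n C k) {{nCk≢0 k≤n}} ⟩
  n C k                      ≤⟨ ℕₚ.m≤m+n (n C k) (n C suc k) ⟩
  n C k ℕ.+ n C suc k        ≡⟨ nCk+nC[k+1]≡[n+1]C[k+1] n k ⟩
  suc n C suc k              ∎)
  where open ℕₚ.≤-Reasoning

[1+n]C[1+k]*[1+k]≡[1+n]*nCk : ∀ n k → (suc n C suc k) ℕ.* suc k ≡ suc n ℕ.* (n C k)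
[1+n]C[1+k]*[1+k]≡[1+n]*nCk zero    zero    = refl
[1+n]C[1+k]*[1+k]≡[1+n]*nCk zero    (suc k) = refl
[1+n]C[1+k]*[1+k]≡[1+n]*nCk (suc n) zero    = cong (ℕ._* 1) (nC1≡n (suc (suc n)))
[1+n]C[1+k]*[1+k]≡[1+n]*nCk (suc n) (suc k) = begin
  (suc (suc n) C suc (suc k)) ℕ.* suc (suc k)
    ≡⟨ cong (ℕ._* suc (suc k)) (nCk+nC[k+1]≡[n+1]C[k+1] (suc n) (suc k)) ⟨
  (c ℕ.+ c′) ℕ.* suc (suc k)
    ≡⟨ expand c c′ k ⟩
  c ℕ.* suc k ℕ.+ c′ ℕ.* suc (suc k) ℕ.+ c
    ≡⟨ cong₂ (λ x y → x ℕ.+ y ℕ.+ c) ([1+n]C[1+k]*[1+k]≡[1+n]*nCk n k) ([1+n]C[1+k]*[1+k]≡[1+n]*nCk n (suc k)) ⟩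
  suc n ℕ.* (n C k) ℕ.+ suc n ℕ.* (n C suc k) ℕ.+ c
    ≡⟨ cong (ℕ._+ c) (ℕₚ.*-distribˡ-+ (suc n) (n C k) (n C suc k)) ⟨
  suc n ℕ.* (n C k ℕ.+ n C suc k) ℕ.+ c
    ≡⟨ cong (λ x → suc n ℕ.* x ℕ.+ c) (nCk+nC[k+1]≡[n+1]C[k+1] n k) ⟩
  suc n ℕ.* c ℕ.+ c
    ≡⟨ ℕₚ.+-comm (suc n ℕ.* c) c ⟩
  suc (suc n) ℕ.* c
    ∎
  where
  open ≡-Reasoning
  c  = suc n C suc k
  c′ = suc n C suc (suc k)
  expand : ∀ c c′ k → (c ℕ.+ c′) ℕ.* suc (suc k) ≡ c ℕ.* suc k ℕ.+ c′ ℕ.* suc (suc k) ℕ.+ c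
  expand = ℕ-Solver.solve-∀

-- Moments of a solution of a first-order recurrence

scaledRising : ℚ → ℕ → ℚ
scaledRising ε zero    = 1ℚ
scaledRising ε (suc k) = scaledRising ε k * (1ℚ + ε * ℕ→ℚ (suc k))

module Moments (ε α β : ℚ) (F : ℕ → ℚ)
               (ΔF-rec : ∀ j → (1ℚ + ε * ℕ→ℚ (suc j)) * Δ F j ≡ ε + (α + β * ℕ→ℚ j) * F j)
               where

  moment : ℕ → ℚ
  moment k = Δ^ k F 0

  moment-rec : ∀ m → (1ℚ + ε * ℕ→ℚ (suc (suc m))) * moment (suc (suc m))
                     ≡ (α + ℕ→ℚ (suc m) * (β - ε)) * moment (suc m) + ℕ→ℚ (suc m) * β * moment m
  moment-rec m = begin
    (1ℚ + ε * ℕ→ℚ (suc (suc m))) * v₂                  ≡⟨ cong (λ t → (1ℚ + ε * t) * v₂) (ℕ→ℚ-suc (suc m)) ⟩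
    (1ℚ + ε * (1ℚ + K)) * v₂                           ≡⟨ isolate ε K v₁ v₂ ⟩
    ((1ℚ + ε) * v₂ + ε * (K * (v₁ + v₂))) - ε * K * v₁  ≡⟨ cong (_- ε * K * v₁) differenced ⟩
    (α * v₁ + β * (K * (v₀ + v₁))) - ε * K * v₁         ≡⟨ collect ε α β K v₀ v₁ ⟩
    (α + K * (β - ε)) * v₁ + K * β * v₀                 ∎
    where
    open ≡-Reasoning
    K  = ℕ→ℚ (suc m)
    v₀ = moment m
    v₁ = moment (suc m)
    v₂ = moment (suc (suc m))
    ΔF-rec-affine : ∀ j → (1ℚ + ε) * Δ F j + ε * (ℕ→ℚ j * Δ F j) ≡ ε + (α * F j + β * (ℕ→ℚ j * F j))
    ΔF-rec-affine j = begin
      (1ℚ + ε) * Δ F j + ε * (ℕ→ℚ j * Δ F j)  ≡⟨ expand ε (ℕ→ℚ j) (Δ F j) ⟩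
      (1ℚ + ε * (1ℚ + ℕ→ℚ j)) * Δ F j         ≡⟨ cong (λ t → (1ℚ + ε * t) * Δ F j) (ℕ→ℚ-suc j) ⟨
      (1ℚ + ε * ℕ→ℚ (suc j)) * Δ F j          ≡⟨ ΔF-rec j ⟩
      ε + (α + β * ℕ→ℚ j) * F j               ≡⟨ distrib ε α β (ℕ→ℚ j) (F j) ⟩
      ε + (α * F j + β * (ℕ→ℚ j * F j))       ∎
      where
      expand : ∀ ε J d → (1ℚ + ε) * d + ε * (J * d) ≡ (1ℚ + ε * (1ℚ + J)) * d
      expand = solve-∀ ℚ-ring
      distrib : ∀ ε α β J f → ε + (α + β * J) * f ≡ ε + (α * f + β * (J * f))
      distrib = solve-∀ ℚ-ring
    differenced : (1ℚ + ε) * v₂ + ε * (K * (v₁ + v₂)) ≡ α * v₁ + β * (K * (v₀ + v₁))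
    differenced = begin
      (1ℚ + ε) * v₂ + ε * (K * (v₁ + v₂))
        ≡⟨ Δ^-affine m (1ℚ + ε) ε (Δ F) ⟨
      Δ^ (suc m) (λ j → (1ℚ + ε) * Δ F j + ε * (ℕ→ℚ j * Δ F j)) 0
        ≡⟨ Δ^-cong (suc m) ΔF-rec-affine 0 ⟩
      Δ^ (suc m) (λ j → ε + (α * F j + β * (ℕ→ℚ j * F j))) 0
        ≡⟨ Δ^-+ (suc m) (λ _ → ε) (λ j → α * F j + β * (ℕ→ℚ j * F j)) 0 ⟩
      Δ^ (suc m) (λ _ → ε) 0 + Δ^ (suc m) (λ j → α * F j + β * (ℕ→ℚ j * F j)) 0
        ≡⟨ cong₂ _+_ (Δ^-const m ε 0) (Δ^-affine m α β F) ⟩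
      0ℚ + (α * v₁ + β * (K * (v₀ + v₁)))
        ≡⟨ ℚₚ.+-identityˡ _ ⟩
      α * v₁ + β * (K * (v₀ + v₁))
        ∎
    isolate : ∀ ε K v₁ v₂ → (1ℚ + ε * (1ℚ + K)) * v₂ ≡ ((1ℚ + ε) * v₂ + ε * (K * (v₁ + v₂))) - ε * K * v₁
    isolate = solve-∀ ℚ-ring
    collect : ∀ ε α β K v₀ v₁ → (α * v₁ + β * (K * (v₀ + v₁))) - ε * K * v₁ ≡ (α + K * (β - ε)) * v₁ + K * β * v₀
    collect = solve-∀ ℚ-ring

  moment-1 : F 0 ≡ 0ℚ → (1ℚ + ε * 1ℚ) * moment 1 ≡ ε
  moment-1 F0≡0 = begin
    (1ℚ + ε * 1ℚ) * Δ F 0              ≡⟨ ΔF-rec 0 ⟩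
    ε + (α + β * 0ℚ) * F 0             ≡⟨ cong (λ f → ε + (α + β * 0ℚ) * f) F0≡0 ⟩
    ε + (α + β * 0ℚ) * 0ℚ              ≡⟨ vanish ε α β ⟩
    ε                                  ∎
    where
    open ≡-Reasoning
    vanish : ∀ ε α β → ε + (α + β * 0ℚ) * 0ℚ ≡ ε
    vanish = solve-∀ ℚ-ring

  scaledMoment : ℕ → ℚ
  scaledMoment k = scaledRising ε k * moment k

  scaledMoment-0 : F 0 ≡ 0ℚ → scaledMoment 0 ≡ 0ℚ
  scaledMoment-0 F0≡0 = trans (ℚₚ.*-identityˡ (F 0)) F0≡0

  scaledMoment-1 : F 0 ≡ 0ℚ → scaledMoment 1 ≡ ε
  scaledMoment-1 F0≡0 = trans (ℚₚ.*-assoc 1ℚ (1ℚ + ε * 1ℚ) (moment 1))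
                              (trans (ℚₚ.*-identityˡ _) (moment-1 F0≡0))

  scaledMoment-rec : ∀ m → scaledMoment (suc (suc m))
                           ≡ (α + ℕ→ℚ (suc m) * (β - ε)) * scaledMoment (suc m)
                             + ℕ→ℚ (suc m) * β * (1ℚ + ε * ℕ→ℚ (suc m)) * scaledMoment m
  scaledMoment-rec m = begin
    D₁ * (1ℚ + ε * ℕ→ℚ (suc (suc m))) * moment (suc (suc m))
      ≡⟨ ℚₚ.*-assoc D₁ _ _ ⟩
    D₁ * ((1ℚ + ε * ℕ→ℚ (suc (suc m))) * moment (suc (suc m)))
      ≡⟨ cong (D₁ *_) (moment-rec m) ⟩
    D₁ * ((α + K * (β - ε)) * moment (suc m) + K * β * moment m)
      ≡⟨ distribute D₀ ε α β K (moment (suc m)) (moment m) ⟩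
    (α + K * (β - ε)) * (D₁ * moment (suc m)) + K * β * (1ℚ + ε * K) * (D₀ * moment m)
      ∎
    where
    open ≡-Reasoning
    K  = ℕ→ℚ (suc m)
    D₀ = scaledRising ε m
    D₁ = scaledRising ε (suc m)
    distribute : ∀ D₀ ε α β K v₁ v₀ →
      D₀ * (1ℚ + ε * K) * ((α + K * (β - ε)) * v₁ + K * β * v₀)
      ≡ (α + K * (β - ε)) * (D₀ * (1ℚ + ε * K) * v₁) + K * β * (1ℚ + ε * K) * (D₀ * v₀)
    distribute = solve-∀ ℚ-ring

rising≡^*scaledRising : ∀ n k .{{_ : NonZero n}} →
  ℕ→ℚ (rising (suc n) k) ≡ ℕ→ℚ n ^ℚ k * scaledRising (recip n) k
rising≡^*scaledRising n zero    = refl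
rising≡^*scaledRising n (suc k) = begin
  ℕ→ℚ (rising (suc n) k ℕ.* (suc n ℕ.+ k))
    ≡⟨ ℕ→ℚ-* (rising (suc n) k) (suc n ℕ.+ k) ⟩
  ℕ→ℚ (rising (suc n) k) * ℕ→ℚ (suc n ℕ.+ k)
    ≡⟨ cong₂ _*_ (rising≡^*scaledRising n k) (trans (cong ℕ→ℚ (sym (ℕₚ.+-suc n k))) (ℕ→ℚ-+ n (suc k))) ⟩
  N ^ℚ k * D * (N + K)
    ≡⟨ cong (λ t → N ^ℚ k * D * (N + t)) (ℚₚ.*-identityʳ K) ⟨
  N ^ℚ k * D * (N + K * 1ℚ)
    ≡⟨ cong (λ t → N ^ℚ k * D * (N + K * t)) (recip-inverseʳ n) ⟨
  N ^ℚ k * D * (N + K * (N * ε))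
    ≡⟨ factor (N ^ℚ k) D N K ε ⟩
  N * N ^ℚ k * (D * (1ℚ + ε * K))
    ∎
  where
  open ≡-Reasoning
  N = ℕ→ℚ n
  K = ℕ→ℚ (suc k)
  ε = recip n
  D = scaledRising ε k
  factor : ∀ P D N K ε → P * D * (N + K * (N * ε)) ≡ N * P * (D * (1ℚ + ε * K))
  factor = solve-∀ ℚ-ring

rising≢0 : ∀ m k → NonZero (rising (suc m) k)
rising≢0 m zero    = _
rising≢0 m (suc k) = ℕₚ.m*n≢0 (rising (suc m) k) (suc m ℕ.+ k) {{rising≢0 m k}}

odd : ℕ → ℕ
odd zero    = 1
odd (suc h) = suc (suc (odd h))

odd≡1+h+h : ∀ h → odd h ≡ suc (h ℕ.+ h)
odd≡1+h+h zero    = refl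
odd≡1+h+h (suc h) = cong (λ m → suc (suc m)) (trans (odd≡1+h+h h) (sym (ℕₚ.+-suc h h)))

⌊odd/2⌋≡h : ∀ h → ⌊ odd h /2⌋ ≡ h
⌊odd/2⌋≡h zero    = refl
⌊odd/2⌋≡h (suc h) = cong suc (⌊odd/2⌋≡h h)

⌊1+odd/2⌋≡1+h : ∀ h → ⌊ suc (odd h) /2⌋ ≡ suc h
⌊1+odd/2⌋≡1+h zero    = refl
⌊1+odd/2⌋≡1+h (suc h) = cong suc (⌊1+odd/2⌋≡1+h h)

h+h≡h*2 : ∀ h → h ℕ.+ h ≡ h ℕ.* 2
h+h≡h*2 = ℕ-Solver.solve-∀

a%2≡1⇒odd : ∀ a → a % 2 ≡ 1 → ∃ λ h → a ≡ odd h
a%2≡1⇒odd a a%2≡1 = a ℕ./ 2 , (begin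
  a                                ≡⟨ m≡m%n+[m/n]*n a 2 ⟩
  a % 2 ℕ.+ a ℕ./ 2 ℕ.* 2          ≡⟨ cong (ℕ._+ a ℕ./ 2 ℕ.* 2) a%2≡1 ⟩
  suc (a ℕ./ 2 ℕ.* 2)              ≡⟨ cong suc (h+h≡h*2 (a ℕ./ 2)) ⟨
  suc (a ℕ./ 2 ℕ.+ a ℕ./ 2)        ≡⟨ odd≡1+h+h (a ℕ./ 2) ⟨
  odd (a ℕ./ 2)                    ∎)
  where open ≡-Reasoning

half-odd : ∀ h → half (odd h) ≡ h
half-odd h = begin
  (odd h ∸ 1) ℕ./ 2          ≡⟨ cong (λ m → (m ∸ 1) ℕ./ 2) (odd≡1+h+h h) ⟩
  (h ℕ.+ h) ℕ./ 2            ≡⟨ cong (ℕ._/ 2) (h+h≡h*2 h) ⟩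
  (h ℕ.* 2) ℕ./ 2            ≡⟨ m*n/n≡m h 2 ⟩
  h                          ∎
  where open ≡-Reasoning

sgn-odd : ∀ h → sgn (odd h) ≡ - 1ℚ
sgn-odd zero    = refl
sgn-odd (suc h) = trans (neg-involutive (sgn (odd h))) (sgn-odd h)
  where
  neg-involutive : ∀ s → - - s ≡ s
  neg-involutive = solve-∀ ℚ-ring

odd∸[h∸q]≡1+h+q : ∀ {h q} → q ≤ h → odd h ∸ (h ∸ q) ≡ suc (h ℕ.+ q)
odd∸[h∸q]≡1+h+q {h} {q} q≤h = begin
  odd h ∸ (h ∸ q)                        ≡⟨ cong (_∸ (h ∸ q)) (odd≡1+h+h h) ⟩
  suc (h ℕ.+ h) ∸ (h ∸ q)                ≡⟨ cong (λ m → suc (h ℕ.+ m) ∸ (h ∸ q)) (ℕₚ.m+[n∸m]≡n q≤h) ⟨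
  suc (h ℕ.+ (q ℕ.+ (h ∸ q))) ∸ (h ∸ q)  ≡⟨ cong (λ m → suc m ∸ (h ∸ q)) (ℕₚ.+-assoc h q (h ∸ q)) ⟨
  suc (h ℕ.+ q) ℕ.+ (h ∸ q) ∸ (h ∸ q)    ≡⟨ ℕₚ.m+n∸n≡m (suc (h ℕ.+ q)) (h ∸ q) ⟩
  suc (h ℕ.+ q)                          ∎
  where open ≡-Reasoning

h<odd : ∀ h → h < odd h
h<odd h = subst (h <_) (sym (odd≡1+h+h h)) (s≤s (ℕₚ.m≤m+n h h))

-- Polynomials in ε and x

Poly : Set
Poly = ℕ → ℕ → ℚ

infixl 6 _⊕_ _⊖_
infixr 7 _⊛_

_⊕_ _⊖_ : Poly → Poly → Poly
(f ⊕ g) q p = f q p + g q p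
(f ⊖ g) q p = f q p - g q p

_⊛_ : ℚ → Poly → Poly
(c ⊛ g) q p = c * g q p

mulε mulx : Poly → Poly
mulε g zero    p = 0ℚ
mulε g (suc q) p = g q p
mulx g q zero    = 0ℚ
mulx g q (suc p) = g q p

SupportedIn : ℕ → ℕ → Poly → Set
SupportedIn lo hi g = ∀ q p → q ℕ.+ p < lo ⊎ hi ≤ q ℕ.+ p → g q p ≡ 0ℚ

module _ {lo hi : ℕ} where

  supportedIn-⊕ : ∀ {f g} → SupportedIn lo hi f → SupportedIn lo hi g → SupportedIn lo hi (f ⊕ g)
  supportedIn-⊕ f₀ g₀ q p out = cong₂ _+_ (f₀ q p out) (g₀ q p out)

  supportedIn-⊖ : ∀ {f g} → SupportedIn lo hi f → SupportedIn lo hi g → SupportedIn lo hi (f ⊖ g)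
  supportedIn-⊖ f₀ g₀ q p out = cong₂ _-_ (f₀ q p out) (g₀ q p out)

  supportedIn-⊛ : ∀ c {g} → SupportedIn lo hi g → SupportedIn lo hi (c ⊛ g)
  supportedIn-⊛ c g₀ q p out = trans (cong (c *_) (g₀ q p out)) (ℚₚ.*-zeroʳ c)

  supportedIn-mulε : ∀ {g} → SupportedIn lo hi g → SupportedIn (suc lo) (suc hi) (mulε g)
  supportedIn-mulε g₀ zero    p out = refl
  supportedIn-mulε g₀ (suc q) p (inj₁ (s≤s lt)) = g₀ q p (inj₁ lt)
  supportedIn-mulε g₀ (suc q) p (inj₂ (s≤s ge)) = g₀ q p (inj₂ ge)

  supportedIn-mulx : ∀ {g} → SupportedIn lo hi g → SupportedIn (suc lo) (suc hi) (mulx g)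
  supportedIn-mulx g₀ q zero    out = refl
  supportedIn-mulx {g} g₀ q (suc p) out = g₀ q p (shift (subst (λ w → w < suc lo ⊎ suc hi ≤ w) (ℕₚ.+-suc q p) out))
    where
    shift : suc (q ℕ.+ p) < suc lo ⊎ suc hi ≤ suc (q ℕ.+ p) → q ℕ.+ p < lo ⊎ hi ≤ q ℕ.+ p
    shift (inj₁ (s≤s lt)) = inj₁ lt
    shift (inj₂ (s≤s ge)) = inj₂ ge

supportedIn-widen : ∀ {lo hi lo′ hi′ g} → lo′ ≤ lo → hi ≤ hi′ → SupportedIn lo hi g → SupportedIn lo′ hi′ g
supportedIn-widen lo′≤lo hi≤hi′ g₀ q p (inj₁ lt) = g₀ q p (inj₁ (ℕₚ.<-≤-trans lt lo′≤lo))
supportedIn-widen lo′≤lo hi≤hi′ g₀ q p (inj₂ ge) = g₀ q p (inj₂ (ℕₚ.≤-trans hi≤hi′ ge))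

module Evaluation (ε x : ℚ) where

  monomial : ℕ → ℕ → ℚ
  monomial q p = ε ^ℚ q * x ^ℚ p

  row : ℕ → Poly → ℕ → ℚ
  row A g q = Σ0 A (λ p → g q p * monomial q p)

  eval : ℕ → Poly → ℚ
  eval A g = Σ0 A (row A g)

  eval-cong : ∀ A {f g} → (∀ q p → f q p ≡ g q p) → eval A f ≡ eval A g
  eval-cong A f≡g = Σ0-cong A (λ q _ → Σ0-cong A (λ p _ → cong (_* monomial q p) (f≡g q p)))

  eval-⊕ : ∀ A f g → eval A (f ⊕ g) ≡ eval A f + eval A g
  eval-⊕ A f g = trans (Σ0-cong A (λ q _ → trans (Σ0-cong A (λ p _ → ℚₚ.*-distribʳ-+ (monomial q p) (f q p) (g q p)))
                                                 (Σ0-distrib-+ A _ _)))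
                       (Σ0-distrib-+ A (row A f) (row A g))

  eval-⊛ : ∀ A c g → eval A (c ⊛ g) ≡ c * eval A g
  eval-⊛ A c g = sym (trans (*-distribˡ-Σ0 A c (row A g))
                            (Σ0-cong A (λ q _ → trans (*-distribˡ-Σ0 A c _)
                                                      (Σ0-cong A (λ p _ → sym (ℚₚ.*-assoc c (g q p) (monomial q p)))))))

  eval-⊖ : ∀ A f g → eval A (f ⊖ g) ≡ eval A f - eval A g
  eval-⊖ A f g = begin
    eval A (f ⊖ g)                 ≡⟨ eval-cong A (λ q p → as-sum (f q p) (g q p)) ⟩
    eval A (f ⊕ (- 1ℚ) ⊛ g)        ≡⟨ eval-⊕ A f ((- 1ℚ) ⊛ g) ⟩
    eval A f + eval A ((- 1ℚ) ⊛ g) ≡⟨ cong (eval A f +_) (eval-⊛ A (- 1ℚ) g) ⟩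
    eval A f + (- 1ℚ) * eval A g   ≡⟨ as-sum (eval A f) (eval A g) ⟨
    eval A f - eval A g            ∎
    where
    open ≡-Reasoning
    as-sum : ∀ a b → a - b ≡ a + (- 1ℚ) * b
    as-sum = solve-∀ ℚ-ring

  eval-mulε : ∀ A {lo hi g} → SupportedIn lo hi g → hi ≤ A → eval (suc A) (mulε g) ≡ ε * eval (suc A) g
  eval-mulε A {g = g} g₀ hi≤A = begin
    eval (suc A) (mulε g)
      ≡⟨ Σ0-suc A (row (suc A) (mulε g)) ⟩
    row (suc A) (mulε g) 0 + Σ0 A (λ q → row (suc A) (mulε g) (suc q))
      ≡⟨ cong₂ _+_ (Σ0-zero (suc A) (λ p _ → ℚₚ.*-zeroˡ (monomial 0 p))) (Σ0-cong A (λ q _ → row-mulε q)) ⟩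
    0ℚ + Σ0 A (λ q → ε * row (suc A) g q)
      ≡⟨ ℚₚ.+-identityˡ _ ⟩
    Σ0 A (λ q → ε * row (suc A) g q)
      ≡⟨ *-distribˡ-Σ0 A ε (row (suc A) g) ⟨
    ε * Σ0 A (row (suc A) g)
      ≡⟨ cong (ε *_) (ℚₚ.+-identityʳ _) ⟨
    ε * (Σ0 A (row (suc A) g) + 0ℚ)
      ≡⟨ cong (λ t → ε * (Σ0 A (row (suc A) g) + t)) (Σ0-zero (suc A) (λ p _ → vanish p)) ⟨
    ε * eval (suc A) g
      ∎
    where
    open ≡-Reasoning
    vanish : ∀ p → g A p * monomial A p ≡ 0ℚ
    vanish p = trans (cong (_* monomial A p) (g₀ A p (inj₂ (ℕₚ.≤-trans hi≤A (ℕₚ.m≤m+n A p))))) (ℚₚ.*-zeroˡ (monomial A p))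
    row-mulε : ∀ q → row (suc A) (mulε g) (suc q) ≡ ε * row (suc A) g q
    row-mulε q = trans (Σ0-cong (suc A) (λ p _ → regroup (g q p) ε (ε ^ℚ q) (x ^ℚ p)))
                       (sym (*-distribˡ-Σ0 (suc A) ε _))
      where
      regroup : ∀ c ε E X → c * (ε * E * X) ≡ ε * (c * (E * X))
      regroup = solve-∀ ℚ-ring

  eval-mulx : ∀ A {lo hi g} → SupportedIn lo hi g → hi ≤ A → eval (suc A) (mulx g) ≡ x * eval (suc A) g
  eval-mulx A {g = g} g₀ hi≤A =
    trans (Σ0-cong (suc A) (λ q _ → row-mulx q)) (sym (*-distribˡ-Σ0 (suc A) x (row (suc A) g)))
    where
    open ≡-Reasoning
    vanish : ∀ q → g q A * monomial q A ≡ 0ℚ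
    vanish q = trans (cong (_* monomial q A) (g₀ q A (inj₂ (ℕₚ.≤-trans hi≤A (ℕₚ.m≤n+m A q))))) (ℚₚ.*-zeroˡ (monomial q A))
    regroup : ∀ c x E X → c * (E * (x * X)) ≡ x * (c * (E * X))
    regroup = solve-∀ ℚ-ring
    row-mulx : ∀ q → row (suc A) (mulx g) q ≡ x * row (suc A) g q
    row-mulx q = begin
      row (suc A) (mulx g) q
        ≡⟨ Σ0-suc A (λ p → mulx g q p * monomial q p) ⟩
      0ℚ * monomial q 0 + Σ0 A (λ p → g q p * monomial q (suc p))
        ≡⟨ cong₂ _+_ (ℚₚ.*-zeroˡ (monomial q 0)) (Σ0-cong A (λ p _ → regroup (g q p) x (ε ^ℚ q) (x ^ℚ p))) ⟩
      0ℚ + Σ0 A (λ p → x * (g q p * monomial q p))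
        ≡⟨ ℚₚ.+-identityˡ _ ⟩
      Σ0 A (λ p → x * (g q p * monomial q p))
        ≡⟨ *-distribˡ-Σ0 A x _ ⟨
      x * Σ0 A (λ p → g q p * monomial q p)
        ≡⟨ cong (x *_) (ℚₚ.+-identityʳ _) ⟨
      x * (Σ0 A (λ p → g q p * monomial q p) + 0ℚ)
        ≡⟨ cong (λ t → x * (Σ0 A (λ p → g q p * monomial q p) + t)) (vanish q) ⟨
      x * row (suc A) g q
        ∎

mulα mulβ : Poly → Poly
mulα g = ½ ⊛ mulx g ⊖ mulε g
mulβ g = mulx g ⊖ mulε g

one : Poly
one zero zero = 1ℚ
one _    _    = 0ℚ

-- scaledMoment-rec with α = ½x − ε, β = x − ε, acting on coefficient arrays
recStep : ℚ → Poly → Poly → Poly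
recStep K g₁ g₀ = mulα g₁ ⊕ K ⊛ (mulβ g₁ ⊖ mulε g₁) ⊕ K ⊛ (mulβ g₀ ⊕ K ⊛ mulε (mulβ g₀))

coeff : ℕ → Poly
coeff zero          _ _ = 0ℚ
coeff (suc zero)        = one
coeff (suc (suc m))     = recStep (ℕ→ℚ (suc m)) (coeff (suc m)) (coeff m)

module _ {lo hi : ℕ} {g : Poly} (g₀ : SupportedIn lo hi g) where

  supportedIn-mulα : SupportedIn (suc lo) (suc hi) (mulα g)
  supportedIn-mulα = supportedIn-⊖ (supportedIn-⊛ ½ (supportedIn-mulx g₀)) (supportedIn-mulε g₀)

  supportedIn-mulβ : SupportedIn (suc lo) (suc hi) (mulβ g)
  supportedIn-mulβ = supportedIn-⊖ (supportedIn-mulx g₀) (supportedIn-mulε g₀)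

coeff-supported : ∀ m → SupportedIn ⌊ m /2⌋ m (coeff m)
coeff-supported zero          q p _ = refl
coeff-supported (suc zero)    zero    zero    (inj₂ ())
coeff-supported (suc zero)    zero    (suc p) _ = refl
coeff-supported (suc zero)    (suc q) p       _ = refl
coeff-supported (suc (suc m)) =
  supportedIn-⊕ (supportedIn-⊕ (from-b₁ (supportedIn-mulα (coeff-supported (suc m))))
                               (supportedIn-⊛ K (supportedIn-⊖ (from-b₁ (supportedIn-mulβ (coeff-supported (suc m))))
                                                               (from-b₁ (supportedIn-mulε (coeff-supported (suc m)))))))
                (supportedIn-⊛ K (supportedIn-⊕ (supportedIn-widen ℕₚ.≤-refl (ℕₚ.n≤1+n (suc m)) b₀β)
                                                (supportedIn-⊛ K (supportedIn-widen (ℕₚ.n≤1+n _) ℕₚ.≤-refl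
                                                                                    (supportedIn-mulε b₀β)))))
  where
  K = ℕ→ℚ (suc m)
  from-b₁ : ∀ {g} → SupportedIn (suc ⌊ suc m /2⌋) (suc (suc m)) g → SupportedIn (suc ⌊ m /2⌋) (suc (suc m)) g
  from-b₁ = supportedIn-widen (s≤s (ℕₚ.⌊n/2⌋-mono (ℕₚ.n≤1+n m))) ℕₚ.≤-refl
  b₀β : SupportedIn (suc ⌊ m /2⌋) (suc m) (mulβ (coeff m))
  b₀β = supportedIn-mulβ (coeff-supported m)

module _ (ε x : ℚ) where

  open Evaluation ε x

  module _ (A : ℕ) {lo hi : ℕ} {g : Poly} (g₀ : SupportedIn lo hi g) (hi≤A : hi ≤ A) where

    eval-mulα : eval (suc A) (mulα g) ≡ (½ * x - ε) * eval (suc A) g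
    eval-mulα = begin
      eval (suc A) (½ ⊛ mulx g ⊖ mulε g)                     ≡⟨ eval-⊖ (suc A) (½ ⊛ mulx g) (mulε g) ⟩
      eval (suc A) (½ ⊛ mulx g) - eval (suc A) (mulε g)      ≡⟨ cong₂ _-_ (eval-⊛ (suc A) ½ (mulx g)) (eval-mulε A g₀ hi≤A) ⟩
      ½ * eval (suc A) (mulx g) - ε * eval (suc A) g         ≡⟨ cong (λ t → ½ * t - ε * eval (suc A) g) (eval-mulx A g₀ hi≤A) ⟩
      ½ * (x * eval (suc A) g) - ε * eval (suc A) g          ≡⟨ factor ½ x ε (eval (suc A) g) ⟩
      (½ * x - ε) * eval (suc A) g                           ∎
      where
      open ≡-Reasoning
      factor : ∀ h x ε E → h * (x * E) - ε * E ≡ (h * x - ε) * E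
      factor = solve-∀ ℚ-ring

    eval-mulβ : eval (suc A) (mulβ g) ≡ (x - ε) * eval (suc A) g
    eval-mulβ = begin
      eval (suc A) (mulx g ⊖ mulε g)                   ≡⟨ eval-⊖ (suc A) (mulx g) (mulε g) ⟩
      eval (suc A) (mulx g) - eval (suc A) (mulε g)    ≡⟨ cong₂ _-_ (eval-mulx A g₀ hi≤A) (eval-mulε A g₀ hi≤A) ⟩
      x * eval (suc A) g - ε * eval (suc A) g          ≡⟨ factor x ε (eval (suc A) g) ⟩
      (x - ε) * eval (suc A) g                         ∎
      where
      open ≡-Reasoning
      factor : ∀ x ε E → x * E - ε * E ≡ (x - ε) * E
      factor = solve-∀ ℚ-ring

  eval-recStep : ∀ A K {lo₁ hi₁ lo₀ hi₀ g₁ g₀} →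
    SupportedIn lo₁ hi₁ g₁ → hi₁ ≤ A → SupportedIn lo₀ hi₀ g₀ → suc hi₀ ≤ A →
    eval (suc A) (recStep K g₁ g₀)
    ≡ ((½ * x - ε) + K * ((x - ε) - ε)) * eval (suc A) g₁ + K * (x - ε) * (1ℚ + ε * K) * eval (suc A) g₀
  eval-recStep A K {g₁ = g₁} {g₀} g₁-supp hi₁≤A g₀-supp hi₀<A = begin
    eval (suc A) (mulα g₁ ⊕ K ⊛ (mulβ g₁ ⊖ mulε g₁) ⊕ K ⊛ (mulβ g₀ ⊕ K ⊛ mulε (mulβ g₀)))
      ≡⟨ eval-⊕ (suc A) (mulα g₁ ⊕ K ⊛ (mulβ g₁ ⊖ mulε g₁)) _ ⟩
    eval (suc A) (mulα g₁ ⊕ K ⊛ (mulβ g₁ ⊖ mulε g₁)) + eval (suc A) (K ⊛ (mulβ g₀ ⊕ K ⊛ mulε (mulβ g₀)))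
      ≡⟨ cong₂ _+_ (trans (eval-⊕ (suc A) (mulα g₁) _) (cong (eval (suc A) (mulα g₁) +_) (eval-⊛ (suc A) K _)))
                   (eval-⊛ (suc A) K _) ⟩
    eval (suc A) (mulα g₁) + K * eval (suc A) (mulβ g₁ ⊖ mulε g₁) + K * eval (suc A) (mulβ g₀ ⊕ K ⊛ mulε (mulβ g₀))
      ≡⟨ cong₂ (λ s t → eval (suc A) (mulα g₁) + K * s + K * t)
               (eval-⊖ (suc A) (mulβ g₁) (mulε g₁))
               (trans (eval-⊕ (suc A) (mulβ g₀) _) (cong (eval (suc A) (mulβ g₀) +_) (eval-⊛ (suc A) K _))) ⟩
    eval (suc A) (mulα g₁) + K * (eval (suc A) (mulβ g₁) - eval (suc A) (mulε g₁))
      + K * (eval (suc A) (mulβ g₀) + K * eval (suc A) (mulε (mulβ g₀)))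
      ≡⟨ cong₂ (λ s t → s + K * t + K * (eval (suc A) (mulβ g₀) + K * eval (suc A) (mulε (mulβ g₀))))
               (eval-mulα A g₁-supp hi₁≤A)
               (cong₂ _-_ (eval-mulβ A g₁-supp hi₁≤A) (eval-mulε A g₁-supp hi₁≤A)) ⟩
    (½ * x - ε) * E₁ + K * ((x - ε) * E₁ - ε * E₁)
      + K * (eval (suc A) (mulβ g₀) + K * eval (suc A) (mulε (mulβ g₀)))
      ≡⟨ cong (λ t → (½ * x - ε) * E₁ + K * ((x - ε) * E₁ - ε * E₁) + K * (eval (suc A) (mulβ g₀) + K * t))
              (eval-mulε A (supportedIn-mulβ g₀-supp) hi₀<A) ⟩
    (½ * x - ε) * E₁ + K * ((x - ε) * E₁ - ε * E₁) + K * (eval (suc A) (mulβ g₀) + K * (ε * eval (suc A) (mulβ g₀)))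
      ≡⟨ cong (λ t → (½ * x - ε) * E₁ + K * ((x - ε) * E₁ - ε * E₁) + K * (t + K * (ε * t)))
              (eval-mulβ A g₀-supp (ℕₚ.<⇒≤ hi₀<A)) ⟩
    (½ * x - ε) * E₁ + K * ((x - ε) * E₁ - ε * E₁) + K * ((x - ε) * E₀ + K * (ε * ((x - ε) * E₀)))
      ≡⟨ collect ½ x ε K E₁ E₀ ⟩
    ((½ * x - ε) + K * ((x - ε) - ε)) * E₁ + K * (x - ε) * (1ℚ + ε * K) * E₀
      ∎
    where
    open ≡-Reasoning
    E₁ = eval (suc A) g₁
    E₀ = eval (suc A) g₀
    collect : ∀ h x ε K E₁ E₀ →
      (h * x - ε) * E₁ + K * ((x - ε) * E₁ - ε * E₁) + K * ((x - ε) * E₀ + K * (ε * ((x - ε) * E₀)))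
      ≡ ((h * x - ε) + K * ((x - ε) - ε)) * E₁ + K * (x - ε) * (1ℚ + ε * K) * E₀
    collect = solve-∀ ℚ-ring

  eval-one : ∀ A → eval (suc A) one ≡ 1ℚ
  eval-one A = begin
    eval (suc A) one                                 ≡⟨ Σ0-suc A (row (suc A) one) ⟩
    row (suc A) one 0 + Σ0 A (λ q → row (suc A) one (suc q))
      ≡⟨ cong₂ _+_ (Σ0-suc A (λ p → one 0 p * monomial 0 p))
                   (Σ0-zero A (λ q _ → Σ0-zero (suc A) (λ p _ → ℚₚ.*-zeroˡ (monomial (suc q) p)))) ⟩
    1ℚ * (1ℚ * 1ℚ) + Σ0 A (λ p → 0ℚ * monomial 0 (suc p)) + 0ℚ
      ≡⟨ cong (λ t → 1ℚ * (1ℚ * 1ℚ) + t + 0ℚ) (Σ0-zero A (λ p _ → ℚₚ.*-zeroˡ (monomial 0 (suc p)))) ⟩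
    1ℚ                                                ∎
    where open ≡-Reasoning

  eval-zero : ∀ A → eval A (coeff 0) ≡ 0ℚ
  eval-zero A = Σ0-zero A (λ q _ → Σ0-zero A (λ p _ → ℚₚ.*-zeroˡ (monomial q p)))

  coeff-solves : (w : ℕ → ℚ) → w 0 ≡ 0ℚ → w 1 ≡ ε →
    (∀ m → w (suc (suc m)) ≡ ((½ * x - ε) + ℕ→ℚ (suc m) * ((x - ε) - ε)) * w (suc m)
                             + ℕ→ℚ (suc m) * (x - ε) * (1ℚ + ε * ℕ→ℚ (suc m)) * w m) →
    ∀ m A → m ≤ A → ε * eval A (coeff m) ≡ w m
  coeff-solves w w₀ w₁ w-rec zero          A       _   = trans (cong (ε *_) (eval-zero A)) (trans (ℚₚ.*-zeroʳ ε) (sym w₀))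
  coeff-solves w w₀ w₁ w-rec (suc zero)    (suc A) _   = trans (cong (ε *_) (eval-one A)) (trans (ℚₚ.*-identityʳ ε) (sym w₁))
  coeff-solves w w₀ w₁ w-rec (suc (suc m)) (suc A) m<A = begin
    ε * eval (suc A) (coeff (suc (suc m)))
      ≡⟨ cong (ε *_) (eval-recStep A K (coeff-supported (suc m)) (ℕₚ.≤-pred m<A) (coeff-supported m) (ℕₚ.≤-pred m<A)) ⟩
    ε * (c₁ * eval (suc A) (coeff (suc m)) + c₀ * eval (suc A) (coeff m))
      ≡⟨ distribute ε c₁ c₀ (eval (suc A) (coeff (suc m))) (eval (suc A) (coeff m)) ⟩
    c₁ * (ε * eval (suc A) (coeff (suc m))) + c₀ * (ε * eval (suc A) (coeff m))
      ≡⟨ cong₂ (λ s t → c₁ * s + c₀ * t) (coeff-solves w w₀ w₁ w-rec (suc m) (suc A) 1+m≤1+A)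
                                          (coeff-solves w w₀ w₁ w-rec m (suc A) (ℕₚ.≤-trans (ℕₚ.n≤1+n m) 1+m≤1+A)) ⟩
    c₁ * w (suc m) + c₀ * w m
      ≡⟨ w-rec m ⟨
    w (suc (suc m))
      ∎
    where
    open ≡-Reasoning
    K  = ℕ→ℚ (suc m)
    c₁ = (½ * x - ε) + K * ((x - ε) - ε)
    c₀ = K * (x - ε) * (1ℚ + ε * K)
    1+m≤1+A : suc m ≤ suc A
    1+m≤1+A = ℕₚ.m≤n⇒m≤1+n (ℕₚ.≤-pred m<A)
    distribute : ∀ ε a b s t → ε * (a * s + b * t) ≡ a * (ε * s) + b * (ε * t)
    distribute = solve-∀ ℚ-ring

evenDoubleFactorial : ℕ → ℕ
evenDoubleFactorial h = 2 ℕ.^ h ℕ.* h !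

evenDoubleFactorial-suc : ∀ h → ℕ→ℚ (evenDoubleFactorial (suc h)) ≡ ℕ→ℚ (suc (odd h)) * ℕ→ℚ (evenDoubleFactorial h)
evenDoubleFactorial-suc h = begin
  ℕ→ℚ (2 ℕ.* 2 ℕ.^ h ℕ.* (h ! ℕ.+ h ℕ.* h !))              ≡⟨ cong ℕ→ℚ (expand h (2 ℕ.^ h) (h !)) ⟩
  ℕ→ℚ (suc (suc (h ℕ.+ h)) ℕ.* evenDoubleFactorial h)      ≡⟨ cong (λ m → ℕ→ℚ (suc m ℕ.* evenDoubleFactorial h)) (odd≡1+h+h h) ⟨
  ℕ→ℚ (suc (odd h) ℕ.* evenDoubleFactorial h)              ≡⟨ ℕ→ℚ-* (suc (odd h)) (evenDoubleFactorial h) ⟩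
  ℕ→ℚ (suc (odd h)) * ℕ→ℚ (evenDoubleFactorial h)          ∎
  where
  open ≡-Reasoning
  expand : ∀ h P F → 2 ℕ.* P ℕ.* (F ℕ.+ h ℕ.* F) ≡ suc (suc (h ℕ.+ h)) ℕ.* (P ℕ.* F)
  expand = ℕ-Solver.solve-∀

mulβ-binomial : ∀ {h E g} → (∀ q p → q ℕ.+ p ≡ h → g q p ≡ ℕ→ℚ (h C q) * sgn q * E) →
                ∀ q p → q ℕ.+ p ≡ suc h → mulβ g q p ≡ ℕ→ℚ (suc h C q) * sgn q * E
mulβ-binomial {h} {E} {g} diag zero    (suc p) qp = begin
  g 0 p - 0ℚ       ≡⟨ ℚₚ.+-identityʳ (g 0 p) ⟩
  g 0 p            ≡⟨ diag 0 p (ℕₚ.suc-injective qp) ⟩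
  1ℚ * 1ℚ * E      ∎
  where open ≡-Reasoning
mulβ-binomial {h} {E} {g} diag (suc q) zero    qp = begin
  0ℚ - g q 0                           ≡⟨ cong (λ v → 0ℚ - v) (diag q 0 q+0≡h) ⟩
  0ℚ - ℕ→ℚ (h C q) * sgn q * E         ≡⟨ cong (λ c → 0ℚ - ℕ→ℚ c * sgn q * E) (nCn≡1′ q≡h) ⟩
  0ℚ - 1ℚ * sgn q * E                  ≡⟨ negate (sgn q) E ⟩
  1ℚ * - sgn q * E                     ≡⟨ cong (λ c → ℕ→ℚ c * - sgn q * E) (nCn≡1′ (cong suc q≡h)) ⟨
  ℕ→ℚ (suc h C suc q) * - sgn q * E    ∎
  where
  open ≡-Reasoning
  q+0≡h : q ℕ.+ 0 ≡ h
  q+0≡h = ℕₚ.suc-injective qp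
  q≡h : q ≡ h
  q≡h = trans (sym (ℕₚ.+-identityʳ q)) q+0≡h
  nCn≡1′ : ∀ {k m} → k ≡ m → m C k ≡ 1
  nCn≡1′ {k} refl = nCn≡1 k
  negate : ∀ s E → 0ℚ - 1ℚ * s * E ≡ 1ℚ * - s * E
  negate = solve-∀ ℚ-ring
mulβ-binomial {h} {E} {g} diag (suc q) (suc p) qp = begin
  g (suc q) p - g q (suc p)
    ≡⟨ cong₂ _-_ (diag (suc q) p (trans (sym (ℕₚ.+-suc q p)) q+1+p≡h)) (diag q (suc p) q+1+p≡h) ⟩
  ℕ→ℚ (h C suc q) * - sgn q * E - ℕ→ℚ (h C q) * sgn q * E
    ≡⟨ collect (ℕ→ℚ (h C q)) (ℕ→ℚ (h C suc q)) (sgn q) E ⟩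
  (ℕ→ℚ (h C q) + ℕ→ℚ (h C suc q)) * - sgn q * E
    ≡⟨ cong (λ c → c * - sgn q * E) (trans (sym (ℕ→ℚ-+ (h C q) (h C suc q))) (cong ℕ→ℚ (nCk+nC[k+1]≡[n+1]C[k+1] h q))) ⟩
  ℕ→ℚ (suc h C suc q) * - sgn q * E
    ∎
  where
  open ≡-Reasoning
  q+1+p≡h : q ℕ.+ suc p ≡ h
  q+1+p≡h = ℕₚ.suc-injective qp
  collect : ∀ c c′ s E → c′ * - s * E - c * s * E ≡ (c + c′) * - s * E
  collect = solve-∀ ℚ-ring

coeff-diagonal : ∀ h q p → q ℕ.+ p ≡ h → coeff (odd h) q p ≡ ℕ→ℚ (h C q) * sgn q * ℕ→ℚ (evenDoubleFactorial h)
coeff-diagonal zero    zero zero _  = refl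
coeff-diagonal (suc h) q    p    qp = begin
  mulα b₁ q p + K * (mulβ b₁ q p - mulε b₁ q p) + K * (mulβ b₀ q p + K * mulε (mulβ b₀) q p)
    ≡⟨ cong₂ (λ s t → s + K * t) (cong₂ (λ s t → s + K * t) (low (supportedIn-mulα b₁-supp))
                                                           (cong₂ _-_ (low (supportedIn-mulβ b₁-supp)) (low (supportedIn-mulε b₁-supp))))
                                 (cong (λ t → mulβ b₀ q p + K * t) (low (supportedIn-mulε (supportedIn-mulβ b₀-supp)))) ⟩
  0ℚ + K * (0ℚ - 0ℚ) + K * (mulβ b₀ q p + K * 0ℚ)
    ≡⟨ simplify K (mulβ b₀ q p) ⟩
  K * mulβ b₀ q p
    ≡⟨ cong (K *_) (mulβ-binomial (coeff-diagonal h) q p qp) ⟩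
  K * (ℕ→ℚ (suc h C q) * sgn q * E)
    ≡⟨ regroup K (ℕ→ℚ (suc h C q) * sgn q) E ⟩
  ℕ→ℚ (suc h C q) * sgn q * (K * E)
    ≡⟨ cong (ℕ→ℚ (suc h C q) * sgn q *_) (evenDoubleFactorial-suc h) ⟨
  ℕ→ℚ (suc h C q) * sgn q * ℕ→ℚ (evenDoubleFactorial (suc h))
    ∎
  where
  open ≡-Reasoning
  K  = ℕ→ℚ (suc (odd h))
  E  = ℕ→ℚ (evenDoubleFactorial h)
  b₀ = coeff (odd h)
  b₁ = coeff (suc (odd h))
  b₀-supp : SupportedIn h (odd h) b₀
  b₀-supp = subst (λ lo → SupportedIn lo (odd h) b₀) (⌊odd/2⌋≡h h) (coeff-supported (odd h))
  b₁-supp : SupportedIn (suc h) (suc (odd h)) b₁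
  b₁-supp = subst (λ lo → SupportedIn lo (suc (odd h)) b₁) (⌊1+odd/2⌋≡1+h h) (coeff-supported (suc (odd h)))
  low : ∀ {hi g} → SupportedIn (suc (suc h)) hi g → g q p ≡ 0ℚ
  low g₀ = g₀ q p (inj₁ (subst (_< suc (suc h)) (sym qp) ℕₚ.≤-refl))
  simplify : ∀ K d → 0ℚ + K * (0ℚ - 0ℚ) + K * (d + K * 0ℚ) ≡ K * d
  simplify = solve-∀ ℚ-ring
  regroup : ∀ K c E → K * (c * E) ≡ c * (K * E)
  regroup = solve-∀ ℚ-ring

-- Γ at half-integers

Γhalf-denominator≢0 : ∀ m → NonZero (4 ℕ.^ m ℕ.* m !)
Γhalf-denominator≢0 m = ℕₚ.m*n≢0 (4 ℕ.^ m) (m !) {{ℕₚ.m^n≢0 4 m}} {{m ℕₚ.!≢0}}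

Γhalf-suc : ∀ m → ℕ→ℚ 2 * Γhalf (suc m) ≡ ℕ→ℚ (suc (2 ℕ.* m)) * Γhalf m
Γhalf-suc m = begin
  ℕ→ℚ 2 * divℕ ((2 ℕ.* suc m) !) (4 ℕ.^ suc m ℕ.* suc m !)
    ≡⟨ *-divℕ 2 ((2 ℕ.* suc m) !) (4 ℕ.^ suc m ℕ.* suc m !) {{Γhalf-denominator≢0 (suc m)}} ⟩
  divℕ (2 ℕ.* (2 ℕ.* suc m) !) (4 ℕ.^ suc m ℕ.* suc m !)
    ≡⟨ divℕ-cross _ _ _ _ {{Γhalf-denominator≢0 (suc m)}} {{Γhalf-denominator≢0 m}} cross ⟩
  divℕ (suc (2 ℕ.* m) ℕ.* (2 ℕ.* m) !) (4 ℕ.^ m ℕ.* m !)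
    ≡⟨ *-divℕ (suc (2 ℕ.* m)) ((2 ℕ.* m) !) (4 ℕ.^ m ℕ.* m !) {{Γhalf-denominator≢0 m}} ⟨
  ℕ→ℚ (suc (2 ℕ.* m)) * divℕ ((2 ℕ.* m) !) (4 ℕ.^ m ℕ.* m !)
    ∎
  where
  open ≡-Reasoning
  2[1+m]≡2+2m : ∀ m → 2 ℕ.* suc m ≡ suc (suc (2 ℕ.* m))
  2[1+m]≡2+2m = ℕ-Solver.solve-∀
  expand : ∀ m F P G → 2 ℕ.* (suc (suc (2 ℕ.* m)) ℕ.* (suc (2 ℕ.* m) ℕ.* F)) ℕ.* (P ℕ.* G)
                       ≡ suc (2 ℕ.* m) ℕ.* F ℕ.* (4 ℕ.* P ℕ.* (G ℕ.+ m ℕ.* G))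
  expand = ℕ-Solver.solve-∀
  cross : 2 ℕ.* (2 ℕ.* suc m) ! ℕ.* (4 ℕ.^ m ℕ.* m !) ≡ suc (2 ℕ.* m) ℕ.* (2 ℕ.* m) ! ℕ.* (4 ℕ.^ suc m ℕ.* suc m !)
  cross = trans (cong (λ k → 2 ℕ.* k ! ℕ.* (4 ℕ.^ m ℕ.* m !)) (2[1+m]≡2+2m m)) (expand m ((2 ℕ.* m) !) (4 ℕ.^ m) (m !))

ℕ→ℚ-1+2m : ∀ m → ℕ→ℚ (suc (2 ℕ.* m)) ≡ 1ℚ + ℕ→ℚ 2 * ℕ→ℚ m
ℕ→ℚ-1+2m m = trans (ℕ→ℚ-suc (2 ℕ.* m)) (cong (1ℚ +_) (ℕ→ℚ-* 2 m))

-- Σ_q (h choose q) (−1)^q B(c + q + 1/2, 3/2) = B(c + 1/2, h + 3/2), divided by π/2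
binomialSum-Γhalf : ∀ h c → binomialSum h (λ q → Γhalf (c ℕ.+ q) * recip (suc (c ℕ.+ q) !))
                            ≡ ℕ→ℚ 2 * Γhalf c * Γhalf (suc h) * recip ((c ℕ.+ suc h) !)
binomialSum-Γhalf zero c = begin
  0ℚ + 1ℚ * 1ℚ * (Γhalf (c ℕ.+ 0) * recip (suc (c ℕ.+ 0) !))
    ≡⟨ cong (λ k → 0ℚ + 1ℚ * 1ℚ * (Γhalf k * recip (suc k !))) (ℕₚ.+-identityʳ c) ⟩
  0ℚ + 1ℚ * 1ℚ * (Γhalf c * recip (suc c !))
    ≡⟨ simplify (Γhalf c) (recip (suc c !)) ⟩
  1ℚ * Γhalf c * recip (suc c !)
    ≡⟨ cong (λ t → t * Γhalf c * recip (suc c !)) 2*Γhalf1≡1 ⟨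
  ℕ→ℚ 2 * Γhalf 1 * Γhalf c * recip (suc c !)
    ≡⟨ swap (ℕ→ℚ 2) (Γhalf 1) (Γhalf c) (recip (suc c !)) ⟩
  ℕ→ℚ 2 * Γhalf c * Γhalf 1 * recip (suc c !)
    ≡⟨ cong (λ k → ℕ→ℚ 2 * Γhalf c * Γhalf 1 * recip (k !)) (ℕₚ.+-comm 1 c) ⟩
  ℕ→ℚ 2 * Γhalf c * Γhalf 1 * recip ((c ℕ.+ 1) !)
    ∎
  where
  open ≡-Reasoning
  2*Γhalf1≡1 : ℕ→ℚ 2 * Γhalf 1 ≡ 1ℚ
  2*Γhalf1≡1 = refl
  simplify : ∀ G R → 0ℚ + 1ℚ * 1ℚ * (G * R) ≡ 1ℚ * G * R
  simplify = solve-∀ ℚ-ring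
  swap : ∀ t g G R → t * g * G * R ≡ t * G * g * R
  swap = solve-∀ ℚ-ring
binomialSum-Γhalf (suc h) c = begin
  binomialSum (suc h) f
    ≡⟨ binomialSum-suc h f ⟩
  binomialSum h f - binomialSum h (λ q → f (suc q))
    ≡⟨ cong (λ s → binomialSum h f - s)
            (binomialSum-cong h (λ q → cong (λ k → Γhalf k * recip (suc k !)) (ℕₚ.+-suc c q))) ⟩
  binomialSum h f - binomialSum h (λ q → Γhalf (suc c ℕ.+ q) * recip (suc (suc c ℕ.+ q) !))
    ≡⟨ cong₂ _-_ (binomialSum-Γhalf h c) (binomialSum-Γhalf h (suc c)) ⟩
  two * Γc * Γh₁ * recip (X !) - two * Γhalf (suc c) * Γh₁ * R
    ≡⟨ cong₂ (λ r t → two * Γc * Γh₁ * r - t * Γh₁ * R) (recip-! X) (Γhalf-suc c) ⟩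
  two * Γc * Γh₁ * (ℕ→ℚ (suc X) * R) - ℕ→ℚ (suc (2 ℕ.* c)) * Γc * Γh₁ * R
    ≡⟨ cong₂ (λ s t → two * Γc * Γh₁ * (s * R) - t * Γc * Γh₁ * R) S≡ (ℕ→ℚ-1+2m c) ⟩
  two * Γc * Γh₁ * ((1ℚ + (c′ + H₁)) * R) - (1ℚ + two * c′) * Γc * Γh₁ * R
    ≡⟨ collect Γc Γh₁ c′ H₁ R ⟩
  Γc * R * ((1ℚ + two * H₁) * Γh₁)
    ≡⟨ cong (λ t → Γc * R * (t * Γh₁)) (ℕ→ℚ-1+2m (suc h)) ⟨
  Γc * R * (ℕ→ℚ (suc (2 ℕ.* suc h)) * Γh₁)
    ≡⟨ cong (Γc * R *_) (Γhalf-suc (suc h)) ⟨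
  Γc * R * (two * Γhalf (suc (suc h)))
    ≡⟨ regroup Γc R two (Γhalf (suc (suc h))) ⟩
  two * Γc * Γhalf (suc (suc h)) * R
    ≡⟨ cong (λ k → two * Γc * Γhalf (suc (suc h)) * recip (k !)) (ℕₚ.+-suc c (suc h)) ⟨
  two * Γc * Γhalf (suc (suc h)) * recip ((c ℕ.+ suc (suc h)) !)
    ∎
  where
  open ≡-Reasoning
  f : ℕ → ℚ
  f q = Γhalf (c ℕ.+ q) * recip (suc (c ℕ.+ q) !)
  two  = ℕ→ℚ 2
  X  = c ℕ.+ suc h
  R  = recip (suc X !)
  c′  = ℕ→ℚ c
  H₁ = ℕ→ℚ (suc h)
  Γc  = Γhalf c
  Γh₁ = Γhalf (suc h)
  S≡ : ℕ→ℚ (suc X) ≡ 1ℚ + (c′ + H₁)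
  S≡ = trans (ℕ→ℚ-suc X) (cong (1ℚ +_) (ℕ→ℚ-+ c (suc h)))
  collect : ∀ Γc Γh₁ c′ H₁ R →
    (1ℚ + 1ℚ) * Γc * Γh₁ * ((1ℚ + (c′ + H₁)) * R) - (1ℚ + (1ℚ + 1ℚ) * c′) * Γc * Γh₁ * R
    ≡ Γc * R * ((1ℚ + (1ℚ + 1ℚ) * H₁) * Γh₁)
  collect = solve-∀ ℚ-ring
  regroup : ∀ G R two G′ → G * R * (two * G′) ≡ two * G * G′ * R
  regroup = solve-∀ ℚ-ring

4^k≡2^k*2^k : ∀ k → 4 ℕ.^ k ≡ 2 ℕ.^ k ℕ.* 2 ℕ.^ k
4^k≡2^k*2^k zero    = refl
4^k≡2^k*2^k (suc k) = trans (cong (4 ℕ.*_) (4^k≡2^k*2^k k)) (square (2 ℕ.^ k))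
  where
  square : ∀ P → 4 ℕ.* (P ℕ.* P) ≡ 2 ℕ.* P ℕ.* (2 ℕ.* P)
  square = ℕ-Solver.solve-∀

evenDoubleFactorial*Γhalf : ∀ h →
  ℕ→ℚ (evenDoubleFactorial h) * Γhalf (suc h) * recip ((suc h ℕ.+ suc h) !) ≡ divℕ 1 (2 ℕ.^ suc h ℕ.* suc (odd h))
evenDoubleFactorial*Γhalf h = begin
  E * divℕ (Y !) D * recip ((suc h ℕ.+ suc h) !)
    ≡⟨ cong₂ (λ s k → s * recip (k !)) (*-divℕ (evenDoubleFactorial h) (Y !) D {{Γhalf-denominator≢0 (suc h)}}) 1+h+1+h≡Y ⟩
  divℕ (evenDoubleFactorial h ℕ.* Y !) D * recip (Y !)
    ≡⟨ divℕ-*-recip _ D (Y !) {{Γhalf-denominator≢0 (suc h)}} {{Y ℕₚ.!≢0}} ⟩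
  divℕ (evenDoubleFactorial h ℕ.* Y !) (D ℕ.* Y !)
    ≡⟨ divℕ-cross _ _ 1 _ {{ℕₚ.m*n≢0 D (Y !) {{Γhalf-denominator≢0 (suc h)}} {{Y ℕₚ.!≢0}}}}
                    {{ℕₚ.m*n≢0 (2 ℕ.^ suc h) (suc (odd h)) {{ℕₚ.m^n≢0 2 (suc h)}}}} cross ⟩
  divℕ 1 (2 ℕ.^ suc h ℕ.* suc (odd h))
    ∎
  where
  open ≡-Reasoning
  E = ℕ→ℚ (evenDoubleFactorial h)
  Y = 2 ℕ.* suc h
  D = 4 ℕ.^ suc h ℕ.* suc h !
  1+h+1+h≡Y : suc h ℕ.+ suc h ≡ Y
  1+h+1+h≡Y = double (suc h)
    where
    double : ∀ m → m ℕ.+ m ≡ 2 ℕ.* m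
    double = ℕ-Solver.solve-∀
  P = 2 ℕ.^ h
  G = h !
  expand : ∀ h P G F → P ℕ.* G ℕ.* F ℕ.* (2 ℕ.* P ℕ.* suc (suc (h ℕ.+ h)))
                       ≡ 1 ℕ.* (4 ℕ.* (P ℕ.* P) ℕ.* (G ℕ.+ h ℕ.* G) ℕ.* F)
  expand = ℕ-Solver.solve-∀
  cross : evenDoubleFactorial h ℕ.* Y ! ℕ.* (2 ℕ.^ suc h ℕ.* suc (odd h)) ≡ 1 ℕ.* (D ℕ.* Y !)
  cross = begin
    P ℕ.* G ℕ.* Y ! ℕ.* (2 ℕ.* P ℕ.* suc (odd h))
      ≡⟨ cong (λ m → P ℕ.* G ℕ.* Y ! ℕ.* (2 ℕ.* P ℕ.* suc m)) (odd≡1+h+h h) ⟩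
    P ℕ.* G ℕ.* Y ! ℕ.* (2 ℕ.* P ℕ.* suc (suc (h ℕ.+ h)))
      ≡⟨ expand h P G (Y !) ⟩
    1 ℕ.* (4 ℕ.* (P ℕ.* P) ℕ.* (G ℕ.+ h ℕ.* G) ℕ.* Y !)
      ≡⟨ cong (λ t → 1 ℕ.* (4 ℕ.* t ℕ.* (G ℕ.+ h ℕ.* G) ℕ.* Y !)) (4^k≡2^k*2^k h) ⟨
    1 ℕ.* (D ℕ.* Y !)
      ∎

-- The sequence F for fixed n and i

1+q+[a∸1∸q]≡a : ∀ {q a} → q < a → suc q ℕ.+ (a ∸ 1 ∸ q) ≡ a
1+q+[a∸1∸q]≡a {q} {suc a} (s≤s q≤a) = cong suc (ℕₚ.m+[n∸m]≡n q≤a)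

module Sequence (n′ i′ : ℕ) (i′≤n′ : i′ ≤ n′) where

  n i : ℕ
  n = suc n′
  i = suc i′

  u ε x : ℚ
  u = invT n i
  ε = recip n
  x = invHalf i

  term : ℕ → ℕ → ℚ
  term j k = divℕ ((n ℕ.+ k ∸ 1) C (k ℕ.+ i ∸ 1)) (((n ℕ.+ j) C (i ℕ.+ j)) ℕ.* (i ℕ.+ j)) * (u ^ℚ (j ∸ k))

  F : ℕ → ℚ
  F j = Σ1 j (term j)

  private
    A : ℕ → ℕ
    A j = (n ℕ.+ j) C (i ℕ.+ j)

    A≢0 : ∀ j → NonZero (A j)
    A≢0 j = nCk≢0 (ℕₚ.+-monoˡ-≤ j (s≤s i′≤n′))

    absorb : ∀ j → ((n ℕ.+ suc j) C (i ℕ.+ suc j)) ℕ.* (i ℕ.+ suc j) ≡ (n ℕ.+ suc j) ℕ.* A j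
    absorb j = shifted n i
      where
      shifted : ∀ N K → ((N ℕ.+ suc j) C (K ℕ.+ suc j)) ℕ.* (K ℕ.+ suc j)
                        ≡ (N ℕ.+ suc j) ℕ.* ((N ℕ.+ j) C (K ℕ.+ j))
      shifted N K rewrite ℕₚ.+-suc N j | ℕₚ.+-suc K j = [1+n]C[1+k]*[1+k]≡[1+n]*nCk (N ℕ.+ j) (K ℕ.+ j)

  term-step : ∀ j k → k ≤ j → ℕ→ℚ (n ℕ.+ suc j) * term (suc j) k ≡ u * ℕ→ℚ (i ℕ.+ j) * term j k
  term-step j k k≤j = begin
    ℕ→ℚ M * (divℕ c (((n ℕ.+ suc j) C (i ℕ.+ suc j)) ℕ.* (i ℕ.+ suc j)) * u ^ℚ (suc j ∸ k))
      ≡⟨ cong₂ (λ d e → ℕ→ℚ M * (divℕ c d * u ^ℚ e)) (absorb j) (ℕₚ.+-∸-assoc 1 k≤j) ⟩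
    ℕ→ℚ M * (divℕ c (M ℕ.* A j) * (u * U))
      ≡⟨ regroup (ℕ→ℚ M) (divℕ c (M ℕ.* A j)) u U ⟩
    ℕ→ℚ M * divℕ c (M ℕ.* A j) * (u * U)
      ≡⟨ cong (_* (u * U)) (*-divℕ-cancelˡ M c (A j) {{_}} {{A≢0 j}}) ⟩
    divℕ c (A j) * (u * U)
      ≡⟨ cong (_* (u * U)) (*-divℕ-cancelˡ P c (A j) {{_}} {{A≢0 j}}) ⟨
    ℕ→ℚ P * divℕ c (P ℕ.* A j) * (u * U)
      ≡⟨ cong (λ d → ℕ→ℚ P * divℕ c d * (u * U)) (ℕₚ.*-comm P (A j)) ⟩
    ℕ→ℚ P * divℕ c (A j ℕ.* P) * (u * U)
      ≡⟨ regroup′ (ℕ→ℚ P) (divℕ c (A j ℕ.* P)) u U ⟩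
    u * ℕ→ℚ P * term j k
      ∎
    where
    open ≡-Reasoning
    M = n ℕ.+ suc j
    P = i ℕ.+ j
    c = (n ℕ.+ k ∸ 1) C (k ℕ.+ i ∸ 1)
    U = u ^ℚ (j ∸ k)
    regroup : ∀ m d u U → m * (d * (u * U)) ≡ m * d * (u * U)
    regroup = solve-∀ ℚ-ring
    regroup′ : ∀ p d u U → p * d * (u * U) ≡ u * p * (d * U)
    regroup′ = solve-∀ ℚ-ring

  term-diag : ∀ j → ℕ→ℚ (n ℕ.+ suc j) * term (suc j) (suc j) ≡ 1ℚ
  term-diag j = begin
    ℕ→ℚ M * (divℕ ((n ℕ.+ suc j ∸ 1) C (suc j ℕ.+ i ∸ 1)) (((n ℕ.+ suc j) C (i ℕ.+ suc j)) ℕ.* (i ℕ.+ suc j)) * u ^ℚ (j ∸ j))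
      ≡⟨ reindex (ℕₚ.+-suc n′ j) (ℕₚ.+-comm j i) (absorb j) (ℕₚ.n∸n≡0 j) ⟩
    ℕ→ℚ M * (divℕ (A j) (M ℕ.* A j) * 1ℚ)
      ≡⟨ cong (ℕ→ℚ M *_) (ℚₚ.*-identityʳ _) ⟩
    ℕ→ℚ M * divℕ (A j) (M ℕ.* A j)
      ≡⟨ *-divℕ-cancelˡ M (A j) (A j) {{_}} {{A≢0 j}} ⟩
    divℕ (A j) (A j)
      ≡⟨ divℕ≡*recip (A j) (A j) {{A≢0 j}} ⟩
    ℕ→ℚ (A j) * recip (A j)
      ≡⟨ recip-inverseʳ (A j) {{A≢0 j}} ⟩
    1ℚ
      ∎
    where
    open ≡-Reasoning
    M = n ℕ.+ suc j
    reindex : ∀ {a a′ b b′ d d′ e e′} → a ≡ a′ → b ≡ b′ → d ≡ d′ → e ≡ e′ →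
            ℕ→ℚ M * (divℕ (a C b) d * u ^ℚ e) ≡ ℕ→ℚ M * (divℕ (a′ C b′) d′ * u ^ℚ e′)
    reindex refl refl refl refl = refl

  F-rec : ∀ j → ℕ→ℚ (n ℕ.+ suc j) * F (suc j) ≡ u * ℕ→ℚ (i ℕ.+ j) * F j + 1ℚ
  F-rec j = begin
    ℕ→ℚ M * (Σ1 j (term (suc j)) + term (suc j) (suc j))
      ≡⟨ ℚₚ.*-distribˡ-+ (ℕ→ℚ M) _ _ ⟩
    ℕ→ℚ M * Σ1 j (term (suc j)) + ℕ→ℚ M * term (suc j) (suc j)
      ≡⟨ cong₂ _+_ (cong (ℕ→ℚ M *_) (Σ1≡Σ0 j (term (suc j)))) (term-diag j) ⟩
    ℕ→ℚ M * Σ0 j (λ k → term (suc j) (suc k)) + 1ℚ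
      ≡⟨ cong (_+ 1ℚ) (*-distribˡ-Σ0 j (ℕ→ℚ M) (λ k → term (suc j) (suc k))) ⟩
    Σ0 j (λ k → ℕ→ℚ M * term (suc j) (suc k)) + 1ℚ
      ≡⟨ cong (_+ 1ℚ) (Σ0-cong j (λ k k<j → term-step j (suc k) k<j)) ⟩
    Σ0 j (λ k → u * ℕ→ℚ (i ℕ.+ j) * term j (suc k)) + 1ℚ
      ≡⟨ cong (_+ 1ℚ) (*-distribˡ-Σ0 j (u * ℕ→ℚ (i ℕ.+ j)) (λ k → term j (suc k))) ⟨
    u * ℕ→ℚ (i ℕ.+ j) * Σ0 j (λ k → term j (suc k)) + 1ℚ
      ≡⟨ cong (λ s → u * ℕ→ℚ (i ℕ.+ j) * s + 1ℚ) (Σ1≡Σ0 j (term j)) ⟨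
    u * ℕ→ℚ (i ℕ.+ j) * F j + 1ℚ
      ∎
    where
    open ≡-Reasoning
    M = n ℕ.+ suc j

  u≡n*x : u ≡ ℕ→ℚ n * x
  u≡n*x = begin
    divℕ (2 ℕ.* n) q            ≡⟨ divℕ≡*recip (2 ℕ.* n) q ⟩
    ℕ→ℚ (2 ℕ.* n) * recip q     ≡⟨ cong (_* recip q) (ℕ→ℚ-* 2 n) ⟩
    ℕ→ℚ 2 * ℕ→ℚ n * recip q     ≡⟨ swap (ℕ→ℚ 2) (ℕ→ℚ n) (recip q) ⟩
    ℕ→ℚ n * (ℕ→ℚ 2 * recip q)   ≡⟨ cong (ℕ→ℚ n *_) (divℕ≡*recip 2 q) ⟨
    ℕ→ℚ n * divℕ 2 q            ∎
    where
    open ≡-Reasoning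
    q = suc (2 ℕ.* i′)
    swap : ∀ a b c → a * b * c ≡ b * (a * c)
    swap = solve-∀ ℚ-ring

  x*i : x * ℕ→ℚ i ≡ 1ℚ + ½ * x
  x*i = begin
    divℕ 2 q * ℕ→ℚ (suc i′)                ≡⟨ cong₂ _*_ (divℕ≡*recip 2 q) (ℕ→ℚ-suc i′) ⟩
    (1ℚ + 1ℚ) * r * (1ℚ + I)               ≡⟨ expand r I ⟩
    r + (1ℚ + (1ℚ + 1ℚ) * I) * r           ≡⟨ cong (λ t → r + t * r) (trans (ℕ→ℚ-suc (2 ℕ.* i′)) (cong (1ℚ +_) (ℕ→ℚ-* 2 i′))) ⟨
    r + ℕ→ℚ q * r                          ≡⟨ cong (r +_) (recip-inverseʳ q) ⟩
    r + 1ℚ                                 ≡⟨ halve r ⟩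
    1ℚ + ½ * ((1ℚ + 1ℚ) * r)               ≡⟨ cong (λ t → 1ℚ + ½ * t) (divℕ≡*recip 2 q) ⟨
    1ℚ + ½ * divℕ 2 q                      ∎
    where
    open ≡-Reasoning
    q = suc (2 ℕ.* i′)
    r = recip q
    I = ℕ→ℚ i′
    expand : ∀ r I → (1ℚ + 1ℚ) * r * (1ℚ + I) ≡ r + (1ℚ + (1ℚ + 1ℚ) * I) * r
    expand = solve-∀ ℚ-ring
    halve : ∀ r → r + 1ℚ ≡ 1ℚ + ½ * ((1ℚ + 1ℚ) * r)
    halve r = begin
      r + 1ℚ                       ≡⟨ ℚₚ.+-comm r 1ℚ ⟩
      1ℚ + r                       ≡⟨ cong (1ℚ +_) (ℚₚ.*-identityˡ r) ⟨
      1ℚ + 1ℚ * r                  ≡⟨ cong (λ t → 1ℚ + t * r) ½*2≡1 ⟨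
      1ℚ + ½ * (1ℚ + 1ℚ) * r       ≡⟨ cong (1ℚ +_) (ℚₚ.*-assoc ½ (1ℚ + 1ℚ) r) ⟩
      1ℚ + ½ * ((1ℚ + 1ℚ) * r)     ∎
      where
      ½*2≡1 : ½ * (1ℚ + 1ℚ) ≡ 1ℚ
      ½*2≡1 = refl

  scaled-rec : ∀ j → (1ℚ + ε * ℕ→ℚ (suc j)) * F (suc j) ≡ x * (ℕ→ℚ i + ℕ→ℚ j) * F j + ε
  scaled-rec j = begin
    (1ℚ + ε * J₁) * F₁                       ≡⟨ cong (λ t → (t + ε * J₁) * F₁) (recip-inverseʳ n) ⟨
    (N * ε + ε * J₁) * F₁                    ≡⟨ factor N ε J₁ F₁ ⟩
    ε * ((N + J₁) * F₁)                      ≡⟨ cong (λ t → ε * (t * F₁)) (ℕ→ℚ-+ n (suc j)) ⟨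
    ε * (ℕ→ℚ (n ℕ.+ suc j) * F₁)             ≡⟨ cong (ε *_) (F-rec j) ⟩
    ε * (u * ℕ→ℚ (i ℕ.+ j) * F₀ + 1ℚ)        ≡⟨ cong₂ (λ s t → ε * (s * t * F₀ + 1ℚ)) u≡n*x (ℕ→ℚ-+ i j) ⟩
    ε * (N * x * (I + J) * F₀ + 1ℚ)          ≡⟨ regroup N ε x I J F₀ ⟩
    N * ε * (x * (I + J) * F₀) + ε           ≡⟨ cong (λ t → t * (x * (I + J) * F₀) + ε) (recip-inverseʳ n) ⟩
    1ℚ * (x * (I + J) * F₀) + ε              ≡⟨ cong (_+ ε) (ℚₚ.*-identityˡ (x * (I + J) * F₀)) ⟩
    x * (I + J) * F₀ + ε                     ∎
    where
    open ≡-Reasoning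
    N = ℕ→ℚ n
    I = ℕ→ℚ i
    J = ℕ→ℚ j
    J₁ = ℕ→ℚ (suc j)
    F₀ = F j
    F₁ = F (suc j)
    factor : ∀ N ε J₁ F₁ → (N * ε + ε * J₁) * F₁ ≡ ε * ((N + J₁) * F₁)
    factor = solve-∀ ℚ-ring
    regroup : ∀ N ε x I J F₀ → ε * (N * x * (I + J) * F₀ + 1ℚ) ≡ N * ε * (x * (I + J) * F₀) + ε
    regroup = solve-∀ ℚ-ring

  ΔF-rec : ∀ j → (1ℚ + ε * ℕ→ℚ (suc j)) * Δ F j ≡ ε + ((½ * x - ε) + (x - ε) * ℕ→ℚ j) * F j
  ΔF-rec j = begin
    (1ℚ + ε * J₁) * (F₁ - F₀)                              ≡⟨ distrib (1ℚ + ε * J₁) F₁ F₀ ⟩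
    (1ℚ + ε * J₁) * F₁ - (1ℚ + ε * J₁) * F₀                ≡⟨ cong₂ (λ s t → s - (1ℚ + ε * t) * F₀) (scaled-rec j) (ℕ→ℚ-suc j) ⟩
    x * (I + J) * F₀ + ε - (1ℚ + ε * (1ℚ + J)) * F₀        ≡⟨ collect ε x I J F₀ ⟩
    ε + ((x * I - 1ℚ) - ε + (x - ε) * J) * F₀              ≡⟨ cong (λ t → ε + ((t - 1ℚ) - ε + (x - ε) * J) * F₀) x*i ⟩
    ε + ((1ℚ + ½ * x - 1ℚ) - ε + (x - ε) * J) * F₀         ≡⟨ cancel ε x ½ J F₀ ⟩
    ε + ((½ * x - ε) + (x - ε) * J) * F₀                   ∎
    where
    open ≡-Reasoning
    I = ℕ→ℚ i
    J = ℕ→ℚ j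
    J₁ = ℕ→ℚ (suc j)
    F₀ = F j
    F₁ = F (suc j)
    distrib : ∀ c a b → c * (a - b) ≡ c * a - c * b
    distrib = solve-∀ ℚ-ring
    collect : ∀ ε x I J F₀ → x * (I + J) * F₀ + ε - (1ℚ + ε * (1ℚ + J)) * F₀
                             ≡ ε + ((x * I - 1ℚ) - ε + (x - ε) * J) * F₀
    collect = solve-∀ ℚ-ring
    cancel : ∀ ε x h J F₀ → ε + ((1ℚ + h * x - 1ℚ) - ε + (x - ε) * J) * F₀ ≡ ε + ((h * x - ε) + (x - ε) * J) * F₀
    cancel = solve-∀ ℚ-ring

  open Moments ε (½ * x - ε) (x - ε) F ΔF-rec
  open Evaluation ε x

  B≡-sgn*moment : ∀ a → B a n i ≡ - (sgn a * moment a)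
  B≡-sgn*moment a = begin
    Σ1 a (λ j → ℕ→ℚ (a C j) * sgn (suc j) * F j)
      ≡⟨ Σ1≡Σ0 a _ ⟩
    Σ0 a (λ j → ℕ→ℚ (a C suc j) * - sgn (suc j) * F (suc j))
      ≡⟨ Σ0-cong a (λ j _ → pull-neg (ℕ→ℚ (a C suc j)) (sgn (suc j)) (F (suc j))) ⟩
    Σ0 a (λ j → - t (suc j))
      ≡⟨ Σ0-neg a (λ j → t (suc j)) ⟩
    - Σ0 a (λ j → t (suc j))
      ≡⟨ cong -_ (ℚₚ.+-identityˡ _) ⟨
    - (0ℚ + Σ0 a (λ j → t (suc j)))
      ≡⟨ cong -_ (Σ0-suc a t) ⟨
    - binomialSum a F
      ≡⟨ cong -_ (binomialSum≡Δ^ a F) ⟩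
    - (sgn a * moment a)
      ∎
    where
    open ≡-Reasoning
    t : ℕ → ℚ
    t j = ℕ→ℚ (a C j) * sgn j * F j
    pull-neg : ∀ c s f → c * - s * f ≡ - (c * s * f)
    pull-neg = solve-∀ ℚ-ring

  B-odd≡moment : ∀ h → B (odd h) n i ≡ moment (odd h)
  B-odd≡moment h = begin
    B (odd h) n i                         ≡⟨ B≡-sgn*moment (odd h) ⟩
    - (sgn (odd h) * moment (odd h))      ≡⟨ cong (λ s → - (s * moment (odd h))) (sgn-odd h) ⟩
    - (- 1ℚ * moment (odd h))             ≡⟨ negate (moment (odd h)) ⟩
    moment (odd h)                        ∎
    where
    open ≡-Reasoning
    negate : ∀ v → - (- 1ℚ * v) ≡ v
    negate = solve-∀ ℚ-ring

  scaledMoment≡ε*eval : ∀ m → ε * eval m (coeff m) ≡ scaledMoment m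
  scaledMoment≡ε*eval m =
    coeff-solves ε x scaledMoment (scaledMoment-0 refl) (scaledMoment-1 refl) scaledMoment-rec m m ℕₚ.≤-refl

  RHS-summand : ∀ h q p → q < odd h →
    (if inS2 (odd h) q p then coeff (odd h) q p * ℕ→ℚ (n ℕ.^ (odd h ∸ 1 ∸ q)) * x ^ℚ p else 0ℚ)
    ≡ ℕ→ℚ (n ℕ.^ odd h) * ε * (coeff (odd h) q p * monomial q p)
  RHS-summand h q p q<a with h ℕ.≤? q ℕ.+ p
  ... | yes h≤q+p = begin
    (if inS2 a q p then v * ℕ→ℚ (n ℕ.^ (a ∸ 1 ∸ q)) * x ^ℚ p else 0ℚ)
      ≡⟨ if-true (subst (λ k → T (k ≤ᵇ q ℕ.+ p)) (sym (half-odd h)) (ℕₚ.≤⇒≤ᵇ h≤q+p)) ⟩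
    v * ℕ→ℚ (n ℕ.^ (a ∸ 1 ∸ q)) * x ^ℚ p
      ≡⟨ cong (λ t → v * t * x ^ℚ p) (ℕ→ℚ-^ n (a ∸ 1 ∸ q)) ⟩
    v * N ^ℚ (a ∸ 1 ∸ q) * x ^ℚ p
      ≡⟨ cong (λ t → v * t * x ^ℚ p) (^ℚ-cancel (recip-inverseʳ n) (suc q) (a ∸ 1 ∸ q)) ⟨
    v * (N ^ℚ (suc q ℕ.+ (a ∸ 1 ∸ q)) * ε ^ℚ suc q) * x ^ℚ p
      ≡⟨ cong (λ k → v * (N ^ℚ k * ε ^ℚ suc q) * x ^ℚ p) (1+q+[a∸1∸q]≡a q<a) ⟩
    v * (N ^ℚ a * (ε * ε ^ℚ q)) * x ^ℚ p
      ≡⟨ regroup v (N ^ℚ a) ε (ε ^ℚ q) (x ^ℚ p) ⟩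
    N ^ℚ a * ε * (v * monomial q p)
      ≡⟨ cong (λ t → t * ε * (v * monomial q p)) (ℕ→ℚ-^ n a) ⟨
    ℕ→ℚ (n ℕ.^ a) * ε * (v * monomial q p)
      ∎
    where
    open ≡-Reasoning
    a = odd h
    v = coeff a q p
    N = ℕ→ℚ n
    regroup : ∀ v P ε E X → v * (P * (ε * E)) * X ≡ P * ε * (v * (E * X))
    regroup = solve-∀ ℚ-ring
  ... | no h≰q+p = begin
    (if inS2 (odd h) q p then v * ℕ→ℚ (n ℕ.^ (odd h ∸ 1 ∸ q)) * x ^ℚ p else 0ℚ)
      ≡⟨ if-false (λ le → h≰q+p (subst (_≤ q ℕ.+ p) (half-odd h) (ℕₚ.≤ᵇ⇒≤ _ _ le))) ⟩
    0ℚ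
      ≡⟨ annihilate (ℕ→ℚ (n ℕ.^ odd h) * ε) (monomial q p) ⟨
    ℕ→ℚ (n ℕ.^ odd h) * ε * (0ℚ * monomial q p)
      ≡⟨ cong (λ t → ℕ→ℚ (n ℕ.^ odd h) * ε * (t * monomial q p)) v≡0 ⟨
    ℕ→ℚ (n ℕ.^ odd h) * ε * (v * monomial q p)
      ∎
    where
    open ≡-Reasoning
    v = coeff (odd h) q p
    v≡0 : v ≡ 0ℚ
    v≡0 = subst (λ lo → SupportedIn lo (odd h) (coeff (odd h))) (⌊odd/2⌋≡h h) (coeff-supported (odd h)) q p
                (inj₁ (ℕₚ.≰⇒> h≰q+p))
    annihilate : ∀ c m → c * (0ℚ * m) ≡ 0ℚ
    annihilate = solve-∀ ℚ-ring

  RHS-odd≡moment : ∀ h → RHS (odd h) (coeff (odd h)) n i ≡ moment (odd h)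
  RHS-odd≡moment h = begin
    divℕ 1 R * Σ0 a (λ q → Σ0 a (λ p → if inS2 a q p then coeff a q p * ℕ→ℚ (n ℕ.^ (a ∸ 1 ∸ q)) * x ^ℚ p else 0ℚ))
      ≡⟨ cong (divℕ 1 R *_) (Σ0-cong a (λ q q<a → Σ0-cong a (λ p _ → RHS-summand h q p q<a))) ⟩
    recip R * Σ0 a (λ q → Σ0 a (λ p → c * (coeff a q p * monomial q p)))
      ≡⟨ cong (recip R *_) (trans (Σ0-cong a (λ q _ → sym (*-distribˡ-Σ0 a c _))) (sym (*-distribˡ-Σ0 a c _))) ⟩
    recip R * (ℕ→ℚ (n ℕ.^ a) * ε * eval a (coeff a))
      ≡⟨ cong (recip R *_) (ℚₚ.*-assoc (ℕ→ℚ (n ℕ.^ a)) ε (eval a (coeff a))) ⟩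
    recip R * (ℕ→ℚ (n ℕ.^ a) * (ε * eval a (coeff a)))
      ≡⟨ cong₂ (λ s t → recip R * (s * t)) (ℕ→ℚ-^ n a) (scaledMoment≡ε*eval a) ⟩
    recip R * (ℕ→ℚ n ^ℚ a * (scaledRising ε a * moment a))
      ≡⟨ regroup (recip R) (ℕ→ℚ n ^ℚ a) (scaledRising ε a) (moment a) ⟩
    recip R * (ℕ→ℚ n ^ℚ a * scaledRising ε a) * moment a
      ≡⟨ cong (λ t → recip R * t * moment a) (rising≡^*scaledRising n a) ⟨
    recip R * ℕ→ℚ R * moment a
      ≡⟨ cong (_* moment a) (recip-inverseˡ R {{rising≢0 n a}}) ⟩
    1ℚ * moment a
      ≡⟨ ℚₚ.*-identityˡ (moment a) ⟩
    moment a
      ∎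
    where
    open ≡-Reasoning
    a = odd h
    R = rising (suc n) a
    c = ℕ→ℚ (n ℕ.^ a) * ε
    regroup : ∀ r P D v → r * (P * (D * v)) ≡ r * (P * D) * v
    regroup = solve-∀ ℚ-ring

betaCoeff*coeff-diagonal : ∀ h q → q ≤ h →
  betaCoeff (odd h) (h ∸ q) * coeff (odd h) q (h ∸ q)
  ≡ ½ * ℕ→ℚ (evenDoubleFactorial h) * (ℕ→ℚ (h C q) * sgn q * (Γhalf (suc h ℕ.+ q) * recip (suc (suc h ℕ.+ q) !)))
betaCoeff*coeff-diagonal h q q≤h = begin
  Γhalf (odd h ∸ (h ∸ q)) * divℕ 1 (2 ℕ.* suc (odd h ∸ (h ∸ q)) !) * coeff (odd h) q (h ∸ q)
    ≡⟨ cong₂ (λ k v → Γhalf k * divℕ 1 (2 ℕ.* suc k !) * v) (odd∸[h∸q]≡1+h+q q≤h)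
                                                            (coeff-diagonal h q (h ∸ q) (ℕₚ.m+[n∸m]≡n q≤h)) ⟩
  Γhalf M * recip (2 ℕ.* suc M !) * (ℕ→ℚ (h C q) * sgn q * E)
    ≡⟨ cong (λ r → Γhalf M * r * (ℕ→ℚ (h C q) * sgn q * E)) (recip-* 2 (suc M !) {{_}} {{suc M ℕₚ.!≢0}}) ⟩
  Γhalf M * (½ * recip (suc M !)) * (ℕ→ℚ (h C q) * sgn q * E)
    ≡⟨ regroup (Γhalf M) ½ (recip (suc M !)) (ℕ→ℚ (h C q) * sgn q) E ⟩
  ½ * E * (ℕ→ℚ (h C q) * sgn q * (Γhalf M * recip (suc M !)))
    ∎
  where
  open ≡-Reasoning
  M = suc (h ℕ.+ q)
  E = ℕ→ℚ (evenDoubleFactorial h)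
  regroup : ∀ g h r c E → g * (h * r) * (c * E) ≡ h * E * (c * (g * r))
  regroup = solve-∀ ℚ-ring

coefficient-identity : ∀ h → identityLHS (odd h) (coeff (odd h)) ≡ gammaRHS (odd h)
coefficient-identity h = begin
  Σ0 (odd h) inner
    ≡⟨ cong (λ m → Σ0 m inner) (odd≡1+h+h h) ⟩
  Σ0 (suc h ℕ.+ h) inner
    ≡⟨ Σ0-truncate (suc h) h (λ q h<q → Σ0-diagonal-empty (odd h) k q (G q) (subst (_< q) (sym (half-odd h)) h<q)) ⟩
  Σ0 (suc h) inner
    ≡⟨ Σ0-cong (suc h) (λ q q<1+h → diagonal q (ℕₚ.≤-pred q<1+h)) ⟩
  Σ0 (suc h) (λ q → ½ * E * (ℕ→ℚ (h C q) * sgn q * f q))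
    ≡⟨ *-distribˡ-Σ0 (suc h) (½ * E) _ ⟨
  ½ * E * binomialSum h f
    ≡⟨ cong (½ * E *_) (binomialSum-Γhalf h (suc h)) ⟩
  ½ * E * (ℕ→ℚ 2 * Γhalf (suc h) * Γhalf (suc h) * recip ((suc h ℕ.+ suc h) !))
    ≡⟨ regroup ½ E (ℕ→ℚ 2) (Γhalf (suc h)) (recip ((suc h ℕ.+ suc h) !)) ⟩
  ½ * ℕ→ℚ 2 * Γhalf (suc h) * (E * Γhalf (suc h) * recip ((suc h ℕ.+ suc h) !))
    ≡⟨ cong (½ * ℕ→ℚ 2 * Γhalf (suc h) *_) (evenDoubleFactorial*Γhalf h) ⟩
  ½ * ℕ→ℚ 2 * Γhalf (suc h) * divℕ 1 (2 ℕ.^ suc h ℕ.* suc (odd h))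
    ≡⟨ cong (_* divℕ 1 (2 ℕ.^ suc h ℕ.* suc (odd h))) (ℚₚ.*-identityˡ (Γhalf (suc h))) ⟩
  Γhalf (suc h) * divℕ 1 (2 ℕ.^ suc h ℕ.* suc (odd h))
    ≡⟨ cong (λ k → Γhalf (suc k) * divℕ 1 (2 ℕ.^ suc k ℕ.* suc (odd h))) (half-odd h) ⟨
  gammaRHS (odd h)
    ∎
  where
  open ≡-Reasoning
  k = half (odd h)
  E = ℕ→ℚ (evenDoubleFactorial h)
  G : ℕ → ℕ → ℚ
  G q p = betaCoeff (odd h) p * coeff (odd h) q p
  inner : ℕ → ℚ
  inner q = Σ0 (odd h) (λ p → if (q ℕ.+ p) ≡ᵇ k then G q p else 0ℚ)
  f : ℕ → ℚ
  f q = Γhalf (suc h ℕ.+ q) * recip (suc (suc h ℕ.+ q) !)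
  diagonal : ∀ q → q ≤ h → inner q ≡ ½ * E * (ℕ→ℚ (h C q) * sgn q * f q)
  diagonal q q≤h = begin
    inner q          ≡⟨ Σ0-diagonal (odd h) k q (G q) (subst (q ≤_) (sym (half-odd h)) q≤h)
                                                      (subst (_< odd h) (sym (half-odd h)) (h<odd h)) ⟩
    G q (k ∸ q)      ≡⟨ cong (λ m → G q (m ∸ q)) (half-odd h) ⟩
    G q (h ∸ q)      ≡⟨ betaCoeff*coeff-diagonal h q q≤h ⟩
    ½ * E * (ℕ→ℚ (h C q) * sgn q * f q)  ∎
  regroup : ∀ h E t g r → h * E * (t * g * g * r) ≡ h * t * g * (E * g * r)
  regroup = solve-∀ ℚ-ring

lemma3 : (a : ℕ) → a % 2 ≡ 1 →
    ∃ λ (b : ℕ → ℕ → ℚ) →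
      ((n i : ℕ) → 1 ≤ i → i ≤ n → B a n i ≡ RHS a b n i)
      × identityLHS a b ≡ gammaRHS a
lemma3 a a%2≡1 with a%2≡1⇒odd a a%2≡1
... | h , refl = coeff (odd h) , expansion , coefficient-identity h
  where
  expansion : (n i : ℕ) → 1 ≤ i → i ≤ n → B (odd h) n i ≡ RHS (odd h) (coeff (odd h)) n i
  expansion (suc n′) (suc i′) _ (s≤s i′≤n′) = trans (B-odd≡moment h) (sym (RHS-odd≡moment h))
    where open Sequence n′ i′ i′≤n′
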